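{- Let $n\ge1$ and let $\Phi$ be the root system of type $A_{n-1}$ as in the context. For every diagonally $\mathfrak S_n$-labelled Dyck path $(\pi,\sigma)$ there is exactly one region $R$ of the Shi arrangement of $\Phi$ such that $R\subseteq\sigma C$ and $FL(R)=\sigma(A_\pi)$, and the resulting map $(\pi,\sigma)\mapsto R$ is a bijection from the set of diagonally $\mathfrak S_n$-labelled Dyck paths of length $n$ onto the set of regions of the Shi arrangement of type $A_{n-1}$. (Equivalently: the map $(\pi,\sigma)\mapsto(A_\pi,\sigma)$ is a bijection onto the set of pairs $(A,w)$ indexing Shi regions via $R\mapsto(w^{ -1}(FL(R)),w)$ where $R\subseteq wC$.)
   Context: Type $A_{n-1}$: $V=\{x\in\mathbb R^n:\sum x_i=0\}$, $\Phi=\{e_i-e_j:i\ne j\}$, $\Phi^+=\{e_i-e_j:i<j\}$; the Weyl group is the symmetric group $\mathfrak S_n$ acting by permuting coordinates, so $\sigma(e_i)=e_{\sigma(i)}$; write $\sigma_i=\sigma(i)$. The dominant chamber is $C=\{x\in V:\langle x,\alpha\rangle>0\ \forall\alpha\in\Phi^+\}$. For $\alpha\in\Phi$, $d\in\mathbb Z$, $H_\alpha^d=\{x:\langle x,\alpha\rangle=d\}$. The Shi arrangement consists of the $H_\alpha^d$ with $\alpha\in\Phi^+$, $d\in\{0,1\}$; its regions are the connected components of the complement of the union of these hyperplanes. A floor of a region $R$ is a hyperplane supporting a facet of $R$ that does not contain the origin and separates $R$ from the origin; $FL(R)=\{\alpha\in\Phi^+: H_\alpha^1 \text{ is a floor of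 } R\}$. A Dyck path of length $n$ is a lattice path from $(0,0)$ to $(n,n)$ with steps $N=(0,1)$, $E=(1,0)$ never going below the line $x=y$. A pair $(i,j)$ is a valley of a path if its $i$-th East step is immediately followed by its $j$-th North step. For a Dyck path $\pi$, $A_\pi=\{e_i-e_j:(i,j)\text{ is a valley of }\pi\}$. A diagonally $\mathfrak S_n$-labelled Dyck path is a pair $(\pi,\sigma)$ of a Dyck path $\pi$ of length $n$ and $\sigma\in\mathfrak S_n$ such that $\sigma_i<\sigma_j$ for every valley $(i,j)$ of $\pi$.
   Formalization: Points of $V$ have rational coordinates rather than real ones, as do the points of the Shi regions, their closures and facets, and the chambers $\sigma C$. -}

module Defs where

open import Data.Nat as ℕ using (ℕ; zero; suc)
open import Data.Fin as Fin using (Fin; toℕ)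
open import Data.Fin.Permutation using (Permutation′; _⟨$⟩ʳ_; _⟨$⟩ˡ_)
open import Data.Rational as ℚ using (ℚ; 0ℚ; 1ℚ; _-_; _+_; ∣_∣)
open import Data.List using (List; []; _∷_; _++_)
open import Data.Product using (Σ; ∃; _×_; _,_; Σ-syntax; ∃-syntax)
open import Data.Sum using (_⊎_)
open import Relation.Binary.PropositionalEquality using (_≡_; _≢_)

Pt : ℕ → Set
Pt n = Fin n → ℚ

sumℚ : ∀ {n} → Pt n → ℚ
sumℚ {zero}  x = 0ℚ
sumℚ {suc n} x = x Fin.zero + sumℚ (λ i → x (Fin.suc i))

InV : ∀ {n} → Pt n → Set
InV x = sumℚ x ≡ 0ℚ

origin : ∀ {n} → Pt n
origin _ = 0ℚ

-- The root e_a - e_b is represented by the pair (a , b) (a ≢ b);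
-- it is positive iff a < b.  ⟨x , e_a - e_b⟩ = x_a - x_b.
pair : ∀ {n} → Pt n → Fin n → Fin n → ℚ
pair x a b = x a - x b

-- Weyl group action: σ(e_i) = e_{σ i}, hence (σ y)_k = y_{σ⁻¹ k}.

act : ∀ {n} → Permutation′ n → Pt n → Pt n
act σ y k = y (σ ⟨$⟩ˡ k)

InC : ∀ {n} → Pt n → Set
InC {n} y = InV y × (∀ (i j : Fin n) → i Fin.< j → 0ℚ ℚ.< pair y i j)

InWC : ∀ {n} → Permutation′ n → Pt n → Set
InWC σ x = Σ[ y ∈ Pt _ ] (InC y × (∀ k → x k ≡ act σ y k))

-- Shi arrangement: hyperplanes H^d_{e_a - e_b}, a < b, d ∈ {0,1}.
-- Its regions are the nonempty cells cut out by a choice, for every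
-- positive root α, of one of the three open strata
--   ⟨x,α⟩ < 0 ,  0 < ⟨x,α⟩ < 1 ,  1 < ⟨x,α⟩ .

data Side : Set where
  below between above : Side

SignVec : ℕ → Set
SignVec n = Fin n → Fin n → Side

inStratum : Side → ℚ → Set
inStratum below   q = q ℚ.< 0ℚ
inStratum between q = (0ℚ ℚ.< q) × (q ℚ.< 1ℚ)
inStratum above   q = 1ℚ ℚ.< q

Cell : ∀ {n} → SignVec n → Pt n → Set
Cell {n} s x = InV x × (∀ (a b : Fin n) → a Fin.< b → inStratum (s a b) (pair x a b))

Region : ℕ → Set
Region n = Σ[ s ∈ SignVec n ] ∃[ x ] Cell s x

_∈R_ : ∀ {n} → Pt n → Region n → Set
x ∈R (s , _) = Cell s x

_≈R_ : ∀ {n} → Region n → Region n → Set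
_≈R_ {n} (s , _) (t , _) = ∀ (a b : Fin n) → a Fin.< b → s a b ≡ t a b

InClosure : ∀ {n} → Region n → Pt n → Set
InClosure R x =
  ∀ (ε : ℚ) → 0ℚ ℚ.< ε → Σ[ y ∈ Pt _ ] (y ∈R R × (∀ k → ∣ x k - y k ∣ ℚ.< ε))

-- The hyperplane H^d_{e_a-e_b} supports a facet of R: H ∩ cl(R) contains
-- a nonempty relatively open subset of H (i.e. it has codimension 1 in V).
SupportsFacet : ∀ {n} → Region n → Fin n → Fin n → ℚ → Set
SupportsFacet R a b d =
  Σ[ x ∈ Pt _ ] Σ[ ε ∈ ℚ ] (0ℚ ℚ.< ε × InV x × pair x a b ≡ d ×
    (∀ z → InV z → pair z a b ≡ d → (∀ k → ∣ z k - x k ∣ ℚ.< ε) → InClosure R z))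

SeparatesFromOrigin : ∀ {n} → Region n → Fin n → Fin n → ℚ → Set
SeparatesFromOrigin R a b d =
    ((pair origin a b ℚ.< d) × (∀ x → x ∈R R → d ℚ.< pair x a b))
  ⊎ ((d ℚ.< pair origin a b) × (∀ x → x ∈R R → pair x a b ℚ.< d))

IsFloor : ∀ {n} → Region n → Fin n → Fin n → ℚ → Set
IsFloor R a b d =
  SupportsFacet R a b d × (pair origin a b ≢ d) × SeparatesFromOrigin R a b d

InFL : ∀ {n} → Region n → Fin n → Fin n → Set
InFL R a b = IsFloor R a b 1ℚ

data Step : Set where
  N E : Step

countN countE : List Step → ℕ
countN []      = 0
countN (N ∷ p) = suc (countN p)
countN (E ∷ p) = countN p
countE []      = 0
countE (N ∷ p) = countE p
countE (E ∷ p) = suc (countE p)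

-- never below the diagonal x = y (x = #E, y = #N), for every prefix
NeverBelow : List Step → Set
NeverBelow p = ∀ (q r : List Step) → p ≡ q ++ r → countE q ℕ.≤ countN q

IsDyck : ℕ → List Step → Set
IsDyck n p = countN p ≡ n × countE p ≡ n × NeverBelow p

-- (i , j) is a valley (0-based indices: the (i+1)-th E step is immediately
-- followed by the (j+1)-th N step).
Valley : ∀ {n} → List Step → Fin n → Fin n → Set
Valley p i j = Σ[ q ∈ List Step ] Σ[ r ∈ List Step ]
  (p ≡ q ++ (E ∷ N ∷ r) × countE q ≡ toℕ i × countN q ≡ toℕ j)

DLDyck : ℕ → Set
DLDyck n = Σ[ p ∈ List Step ] Σ[ σ ∈ Permutation′ n ]
  (IsDyck n p × (∀ (i j : Fin n) → Valley p i j → (σ ⟨$⟩ʳ i) Fin.< (σ ⟨$⟩ʳ j)))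

_≈D_ : ∀ {n} → DLDyck n → DLDyck n → Set
(p , σ , _) ≈D (q , τ , _) = p ≡ q × (∀ i → σ ⟨$⟩ʳ i ≡ τ ⟨$⟩ʳ i)

InσA : ∀ {n} → DLDyck n → Fin n → Fin n → Set
InσA (p , σ , _) a b =
  Σ[ i ∈ Fin _ ] Σ[ j ∈ Fin _ ] (Valley p i j × σ ⟨$⟩ʳ i ≡ a × σ ⟨$⟩ʳ j ≡ b)

Matches : ∀ {n} → DLDyck n → Region n → Set
Matches {n} P@(p , σ , _) R =
    (∀ x → x ∈R R → InWC σ x)
  × (∀ (a b : Fin n) → a Fin.< b → (InFL R a b → InσA P a b) × (InσA P a b → InFL R a b))

{-# OPTIONS --safe #-}
module Submission where

-- A Shi region R lies in a single chamber σC, σ sorting the coordinates of its points decreasingly, and inside σC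
-- it is determined by its above pairs: the sorted positions i < j for which e_{σi} − e_{σj} is a positive root
-- taking values > 1 on R.  Above pairs are closed under widening [i, j] while the root stays positive, so they are
-- generated by the minimal ones, and these are exactly the floors of R.  At a point of the facet of a floor a
-- strictly nested above pair would force two further coordinates to coincide, which a small move inside the facet
-- breaks; conversely, lowering a minimal pair below H¹ gives a neighbouring region, and the segment from R to it
-- meets H¹ at a point whose neighbourhood in H¹ lies in the closure of R.  Every nesting-closed set of pairs occurs
-- (a point is built one coordinate at a time, each new coordinate interpolated between finitely many bounds), and
-- these sets are exactly the sets {(i, j) : i < height(j)} of Dyck paths, whose minimal pairs are the valleys; the
-- labelling condition σ_i < σ_j says that the valleys are positive roots.

open import Defs
open import Level using (0ℓ)
open import Function using (_∘_; _⇔_; mk⇔; Equivalence)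
open Equivalence using (to; from)
open import Data.Empty using (⊥-elim)
open import Data.Bool using (if_then_else_)
open import Data.Product using (∃₂; _×_; _,_; proj₁; proj₂; Σ-syntax; ∃-syntax)
open import Data.Product.Properties using (≡-dec)
open import Data.Sum using (inj₁; inj₂; [_,_]′)
open import Data.Nat as ℕ using (ℕ; zero; suc; z≤n; s≤s)
import Data.Nat.Properties as ℕP
open import Data.Nat.Induction using (<-wellFounded)
import Data.Integer as ℤ
open import Data.Rational as ℚ using (ℚ; mkℚ; 0ℚ; 1ℚ; ½; _+_; _-_; _*_; -_; 1/_; ∣_∣; _<_; _≤_; _⊓_)
import Data.Rational.Properties as ℚP
open import Data.Fin as Fin using (Fin; toℕ; fromℕ<)
import Data.Fin.Properties as FinP
open import Data.Fin.Permutation using (Permutation′; permutation; _⟨$⟩ʳ_; _⟨$⟩ˡ_; inverseʳ; inverseˡ)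
import Data.Fin.Subset as Subset
import Data.Fin.Subset.Properties as SubsetP
import Data.Vec as Vec
import Data.Vec.Properties as VecP
open import Data.List using (List; []; _∷_; _++_; map; filter; allFin; replicate)
open import Data.List.Membership.Propositional using (_∈_)
open import Data.List.Membership.Propositional.Properties
  using (∈-map⁺; ∈-map⁻; ∈-++⁺ˡ; ∈-++⁺ʳ; ∈-++⁻; ∈-map∘filter⁺; ∈-map∘filter⁻; ∈-allFin)
import Data.List.Relation.Unary.All as All
import Data.List.Extrema
import Algebra.Properties.CommutativeMonoid.Sum as MonoidSum
open import Induction.WellFounded using (Acc; acc)
open import Relation.Nullary using (¬_; Dec; yes; no; does; contradiction)
open import Relation.Nullary.Decidable using (_×-dec_; ¬?; dec⇒maybe; dec-true)
open import Relation.Binary.Bundles using (DecTotalOrder)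
open import Relation.Binary.Definitions using (tri<; tri≈; tri>)
open import Relation.Binary.PropositionalEquality
open import Tactic.RingSolver using (solve-∀)
open import Tactic.RingSolver.Core.AlmostCommutativeRing using (AlmostCommutativeRing; fromCommutativeRing)

ℚ-ring : AlmostCommutativeRing 0ℓ 0ℓ
ℚ-ring = fromCommutativeRing ℚP.+-*-commutativeRing (λ q → dec⇒maybe (0ℚ ℚP.≟ q))

0<1 : 0ℚ < 1ℚ
0<1 = ℚP.positive⁻¹ 1ℚ

+-pos : ∀ {p q} → 0ℚ < p → 0ℚ < q → 0ℚ < p + q
+-pos = ℚP.+-mono-<

*-pos : ∀ {p q} → 0ℚ < p → 0ℚ < q → 0ℚ < p * q
*-pos {p} {q} 0<p 0<q = ℚP.positive⁻¹ (p * q) {{ℚP.pos*pos⇒pos p {{ℚ.positive 0<p}} q {{ℚ.positive 0<q}}}}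

½*-pos : ∀ {p} → 0ℚ < p → 0ℚ < ½ * p
½*-pos = *-pos (ℚP.positive⁻¹ ½)

halves : ∀ r → ½ * r + ½ * r ≡ r
halves = solve-∀ ℚ-ring

0<⊓ : ∀ {p q} → 0ℚ < p → 0ℚ < q → 0ℚ < p ⊓ q
0<⊓ {p} {q} 0<p 0<q = [ (λ e → subst (0ℚ <_) (sym e) 0<p) , (λ e → subst (0ℚ <_) (sym e) 0<q) ]′ (ℚP.⊓-sel p q)

q-p+p≡q : ∀ q p → q - p + p ≡ q
q-p+p≡q = solve-∀ ℚ-ring

p<q⇒0<q-p : ∀ {p q} → p < q → 0ℚ < q - p
p<q⇒0<q-p {p} {q} p<q = subst (_< q - p) (ℚP.+-inverseʳ p) (ℚP.+-monoˡ-< (- p) p<q)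

0<q-p⇒p<q : ∀ {p q} → 0ℚ < q - p → p < q
0<q-p⇒p<q {p} {q} 0<q-p = subst₂ _<_ (ℚP.+-identityˡ p) (q-p+p≡q q p) (ℚP.+-monoˡ-< p 0<q-p)

<-by-gap : ∀ {p q d} → 0ℚ < d → d ≡ q - p → p < q
<-by-gap 0<d refl = 0<q-p⇒p<q 0<d

p≤q⇒0≤q-p : ∀ {p q} → p ≤ q → 0ℚ ≤ q - p
p≤q⇒0≤q-p {p} {q} p≤q = subst (_≤ q - p) (ℚP.+-inverseʳ p) (ℚP.+-monoˡ-≤ (- p) p≤q)

≤-by-gap : ∀ {p q d} → 0ℚ ≤ d → d ≡ q - p → p ≤ q
≤-by-gap {p} {q} 0≤d refl = subst₂ _≤_ (ℚP.+-identityˡ p) (q-p+p≡q q p) (ℚP.+-monoˡ-≤ p 0≤d)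

p<q⇒p-q<0 : ∀ {p q} → p < q → p - q < 0ℚ
p<q⇒p-q<0 {p} {q} p<q = <-by-gap (p<q⇒0<q-p p<q) (flip p q)
  where
  flip : ∀ p q → q - p ≡ 0ℚ - (p - q)
  flip = solve-∀ ℚ-ring

p-q<0⇒p<q : ∀ {p q} → p - q < 0ℚ → p < q
p-q<0⇒p<q {p} {q} p-q<0 = <-by-gap (p<q⇒0<q-p p-q<0) (flip p q)
  where
  flip : ∀ p q → 0ℚ - (p - q) ≡ q - p
  flip = solve-∀ ℚ-ring

p≡q⇒p-q≡0 : ∀ {p q} → p ≡ q → p - q ≡ 0ℚ
p≡q⇒p-q≡0 {q = q} refl = ℚP.+-inverseʳ q

≤∧≢⇒< : ∀ {p q} → p ≤ q → p ≢ q → p < q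
≤∧≢⇒< {p} {q} p≤q p≢q with ℚP.<-cmp p q
... | tri< p<q _ _ = p<q
... | tri≈ _ p≡q _ = contradiction p≡q p≢q
... | tri> _ _ q<p = contradiction (ℚP.<-≤-trans q<p p≤q) (ℚP.<-irrefl refl)

<⇒≱ : ∀ {p q} → p < q → ¬ (q ≤ p)
<⇒≱ p<q q≤p = ℚP.<-irrefl refl (ℚP.<-≤-trans p<q q≤p)

q<q+1 : ∀ q → q < q + 1ℚ
q<q+1 q = <-by-gap 0<1 (sym (gap q))
  where
  gap : ∀ q → (q + 1ℚ) - q ≡ 1ℚ
  gap = solve-∀ ℚ-ring

q-1<q : ∀ q → q - 1ℚ < q
q-1<q q = <-by-gap 0<1 (sym (gap q))
  where
  gap : ∀ q → q - (q - 1ℚ) ≡ 1ℚ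
  gap = solve-∀ ℚ-ring

p<q+r⇒p-q<r : ∀ {p q r} → p < q + r → p - q < r
p<q+r⇒p-q<r {p} {q} {r} p<q+r = <-by-gap (p<q⇒0<q-p p<q+r) (gap p q r)
  where
  gap : ∀ p q r → (q + r) - p ≡ r - (p - q)
  gap = solve-∀ ℚ-ring

q+r<p⇒r<p-q : ∀ {p q r} → q + r < p → r < p - q
q+r<p⇒r<p-q {p} {q} {r} q+r<p = <-by-gap (p<q⇒0<q-p q+r<p) (gap p q r)
  where
  gap : ∀ p q r → p - (q + r) ≡ (p - q) - r
  gap = solve-∀ ℚ-ring

p-q<r⇒p<q+r : ∀ {p q r} → p - q < r → p < q + r
p-q<r⇒p<q+r {p} {q} {r} p-q<r = <-by-gap (p<q⇒0<q-p p-q<r) (gap p q r)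
  where
  gap : ∀ p q r → r - (p - q) ≡ (q + r) - p
  gap = solve-∀ ℚ-ring

nonpos-minus-pos : ∀ {p d} → p ≤ 0ℚ → 0ℚ < d → p - d < 0ℚ
nonpos-minus-pos {p} {d} p≤0 0<d = <-by-gap (ℚP.+-mono-<-≤ 0<d (p≤q⇒0≤q-p p≤0)) (gap p d)
  where
  gap : ∀ p d → d + (0ℚ - p) ≡ 0ℚ - (p - d)
  gap = solve-∀ ℚ-ring

squeeze-sum : ∀ {p q r} → 0ℚ ≤ p → 1ℚ ≤ q → 0ℚ ≤ r → p + q + r ≡ 1ℚ → p ≤ 0ℚ × r ≤ 0ℚ
squeeze-sum {p} {q} {r} 0≤p 1≤q 0≤r sum≡1 =
    ≤-by-gap (ℚP.+-mono-≤ (p≤q⇒0≤q-p 1≤q) 0≤r) (trans (cong (λ s → (q - s) + r) (sym sum≡1)) (left p q r))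
  , ≤-by-gap (ℚP.+-mono-≤ (p≤q⇒0≤q-p 1≤q) 0≤p) (trans (cong (λ s → (q - s) + p) (sym sum≡1)) (right p q r))
  where
  left : ∀ p q r → (q - (p + q + r)) + r ≡ 0ℚ - p
  left = solve-∀ ℚ-ring
  right : ∀ p q r → (q - (p + q + r)) + p ≡ 0ℚ - r
  right = solve-∀ ℚ-ring

crossing : ∀ {p₀ p₁} → p₁ < 1ℚ → 1ℚ < p₀ → ∃[ t ] (0ℚ < t × t < 1ℚ × (1ℚ - t) * p₀ + t * p₁ ≡ 1ℚ)
crossing {p₀} {p₁} p₁<1 1<p₀ = t , *-pos (p<q⇒0<q-p 1<p₀) 0<w , t<1 , on-1
  where
  0<D : 0ℚ < p₀ - p₁
  0<D = p<q⇒0<q-p (ℚP.<-trans p₁<1 1<p₀)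
  instance
    D≢0 : ℚ.NonZero (p₀ - p₁)
    D≢0 = ℚP.pos⇒nonZero (p₀ - p₁) {{ℚ.positive 0<D}}
  w = 1/ (p₀ - p₁)
  0<w : 0ℚ < w
  0<w = ℚP.positive⁻¹ w {{ℚP.1/pos⇒pos (p₀ - p₁) {{ℚ.positive 0<D}}}}
  t = (p₀ - 1ℚ) * w
  t<1 : t < 1ℚ
  t<1 = <-by-gap (*-pos (p<q⇒0<q-p p₁<1) 0<w) (begin
    (1ℚ - p₁) * w         ≡⟨ split p₀ p₁ w ⟩
    (p₀ - p₁) * w - t     ≡⟨ cong (_- t) (ℚP.*-inverseʳ (p₀ - p₁)) ⟩
    1ℚ - t                ∎)
    where
    open ≡-Reasoning
    split : ∀ p q w → (1ℚ - q) * w ≡ (p - q) * w - (p - 1ℚ) * w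
    split = solve-∀ ℚ-ring
  on-1 : (1ℚ - t) * p₀ + t * p₁ ≡ 1ℚ
  on-1 = begin
    (1ℚ - t) * p₀ + t * p₁             ≡⟨ regroup p₀ p₁ w ⟩
    p₀ - (p₀ - 1ℚ) * ((p₀ - p₁) * w)   ≡⟨ cong (λ u → p₀ - (p₀ - 1ℚ) * u) (ℚP.*-inverseʳ (p₀ - p₁)) ⟩
    p₀ - (p₀ - 1ℚ) * 1ℚ                ≡⟨ cancel p₀ ⟩
    1ℚ                                 ∎
    where
    open ≡-Reasoning
    regroup : ∀ p q w → (1ℚ - (p - 1ℚ) * w) * p + ((p - 1ℚ) * w) * q ≡ p - (p - 1ℚ) * ((p - q) * w)
    regroup = solve-∀ ℚ-ring
    cancel : ∀ p → p - (p - 1ℚ) * 1ℚ ≡ 1ℚ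
    cancel = solve-∀ ℚ-ring

∃-small : ∀ {e} → 0ℚ < e → ∃[ δ ] (0ℚ < δ × ∣ δ ∣ + ∣ δ ∣ < e)
∃-small {e} 0<e = ½ * (½ * e) , 0<δ , subst (_< e) (sym (cong₂ _+_ ∣δ∣≡δ ∣δ∣≡δ)) (<-by-gap (½*-pos 0<e) (gap e))
  where
  0<δ = ½*-pos (½*-pos 0<e)
  ∣δ∣≡δ = ℚP.0≤p⇒∣p∣≡p (ℚP.<⇒≤ 0<δ)
  gap : ∀ e → ½ * e ≡ e - (½ * (½ * e) + ½ * (½ * e))
  gap = solve-∀ ℚ-ring

p≤∣p∣ : ∀ p → p ≤ ∣ p ∣
p≤∣p∣ (mkℚ (ℤ.+ _) _ _) = ℚP.≤-refl
p≤∣p∣ p@(mkℚ ℤ.-[1+ _ ] _ _) = ℚP.<⇒≤ (ℚP.<-≤-trans (ℚP.negative⁻¹ p) (ℚP.0≤∣p∣ p))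

∣p-q∣<r⇒p-q<r : ∀ {p q r} → ∣ p - q ∣ < r → p - q < r
∣p-q∣<r⇒p-q<r {p} {q} = ℚP.≤-<-trans (p≤∣p∣ (p - q))

∣p-q∣≡∣q-p∣ : ∀ p q → ∣ p - q ∣ ≡ ∣ q - p ∣
∣p-q∣≡∣q-p∣ p q = trans (cong ∣_∣ (neg-diff p q)) (ℚP.∣-p∣≡∣p∣ (q - p))
  where
  neg-diff : ∀ p q → p - q ≡ - (q - p)
  neg-diff = solve-∀ ℚ-ring

∣p-q∣<r⇒q-p<r : ∀ {p q r} → ∣ p - q ∣ < r → q - p < r
∣p-q∣<r⇒q-p<r {p} {q} h = ∣p-q∣<r⇒p-q<r {q} {p} (subst (_< _) (∣p-q∣≡∣q-p∣ p q) h)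

module ℚExtrema = Data.List.Extrema (DecTotalOrder.totalOrder ℚP.≤-decTotalOrder)

interpolate : (L U : List ℚ) → (∀ {p q} → p ∈ L → q ∈ U → p < q) →
              ∃[ y ] ((∀ {p} → p ∈ L → p < y) × (∀ {q} → q ∈ U → y < q))
interpolate L U L<U = y , (λ p∈L → ℚP.≤-<-trans (All.lookup (ℚExtrema.xs≤max (μ - 1ℚ) L) p∈L) M<y)
                        , (λ q∈U → ℚP.<-≤-trans y<μ (All.lookup (ℚExtrema.min≤xs (ℚExtrema.max 0ℚ L + 1ℚ) U) q∈U))
  where
  strict : ∀ {p q} → p < q → p ≤ q × p ≢ q
  strict p<q = ℚP.<⇒≤ p<q , ℚP.<⇒≢ p<q
  unstrict : ∀ {p q} → p ≤ q × p ≢ q → p < q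
  unstrict (p≤q , p≢q) = ≤∧≢⇒< p≤q p≢q
  -- μ lies strictly above L and at or below U, also when L or U is empty.
  μ = ℚExtrema.min (ℚExtrema.max 0ℚ L + 1ℚ) U
  L<μ : ∀ {p} → p ∈ L → p < μ
  L<μ p∈L = unstrict (ℚExtrema.v<min⁺
    (strict (ℚP.≤-<-trans (All.lookup (ℚExtrema.xs≤max 0ℚ L) p∈L) (q<q+1 _)))
    (All.tabulate (λ q∈U → strict (L<U p∈L q∈U))))
  M = ℚExtrema.max (μ - 1ℚ) L
  M<μ : M < μ
  M<μ = unstrict (ℚExtrema.max<v⁺ (strict (q-1<q μ)) (All.tabulate (strict ∘ L<μ)))
  y = proj₁ (ℚP.<-dense M<μ)
  M<y = proj₁ (proj₂ (ℚP.<-dense M<μ))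
  y<μ = proj₂ (proj₂ (ℚP.<-dense M<μ))

Near : ∀ {n} → ℚ → Pt n → Pt n → Set
Near r x y = ∀ k → ∣ x k - y k ∣ < r

near-trans : ∀ {n r s} {x y z : Pt n} → Near r x y → Near s y z → Near (r + s) x z
near-trans {x = x} {y} {z} x~y y~z k =
  ℚP.≤-<-trans (subst (_≤ ∣ x k - y k ∣ + ∣ y k - z k ∣) (cong ∣_∣ (chain (x k) (y k) (z k)))
                       (ℚP.∣p+q∣≤∣p∣+∣q∣ (x k - y k) (y k - z k)))
               (ℚP.+-mono-< (x~y k) (y~z k))
  where
  chain : ∀ p q r → (p - q) + (q - r) ≡ p - r
  chain = solve-∀ ℚ-ring

near-weaken : ∀ {n r s} {x y : Pt n} → r ≤ s → Near r x y → Near s x y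
near-weaken r≤s x~y k = ℚP.<-≤-trans (x~y k) r≤s

near-sym : ∀ {n r} {x y : Pt n} → Near r x y → Near r y x
near-sym {x = x} {y} x~y k = subst (_< _) (∣p-q∣≡∣q-p∣ (x k) (y k)) (x~y k)

pair-dist : ∀ {n} (x y : Pt n) a b → ∣ pair x a b - pair y a b ∣ ≤ ∣ x a - y a ∣ + ∣ x b - y b ∣
pair-dist x y a b = subst (_≤ ∣ x a - y a ∣ + ∣ x b - y b ∣) (cong ∣_∣ (regroup (x a) (x b) (y a) (y b)))
                          (ℚP.∣p-q∣≤∣p∣+∣q∣ (x a - y a) (x b - y b))
  where
  regroup : ∀ p q s t → (p - s) - (q - t) ≡ (p - q) - (s - t)
  regroup = solve-∀ ℚ-ring

pair-near : ∀ {n r} {x y : Pt n} → Near r x y → ∀ a b → ∣ pair x a b - pair y a b ∣ < r + r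
pair-near {x = x} {y} near a b = ℚP.≤-<-trans (pair-dist x y a b) (ℚP.+-mono-< (near a) (near b))

sumℚ-cong : ∀ {n} {x y : Pt n} → (∀ k → x k ≡ y k) → sumℚ x ≡ sumℚ y
sumℚ-cong {zero} _ = refl
sumℚ-cong {suc n} x≗y = cong₂ _+_ (x≗y Fin.zero) (sumℚ-cong (x≗y ∘ Fin.suc))

sumℚ-+ : ∀ {n} (x y : Pt n) → sumℚ (λ k → x k + y k) ≡ sumℚ x + sumℚ y
sumℚ-+ {zero} x y = refl
sumℚ-+ {suc n} x y =
  trans (cong ((x Fin.zero + y Fin.zero) +_) (sumℚ-+ (x ∘ Fin.suc) (y ∘ Fin.suc)))
        (interchange (x Fin.zero) (y Fin.zero) (sumℚ (x ∘ Fin.suc)) (sumℚ (y ∘ Fin.suc)))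
  where
  interchange : ∀ a b c d → (a + b) + (c + d) ≡ (a + c) + (b + d)
  interchange = solve-∀ ℚ-ring

sumℚ-* : ∀ {n} c (x : Pt n) → sumℚ (λ k → c * x k) ≡ c * sumℚ x
sumℚ-* {zero} c x = sym (ℚP.*-zeroʳ c)
sumℚ-* {suc n} c x = trans (cong (c * x Fin.zero +_) (sumℚ-* c (x ∘ Fin.suc))) (sym (ℚP.*-distribˡ-+ c _ _))

module MonoidSumℚ = MonoidSum ℚP.+-0-commutativeMonoid

sumℚ-permute : ∀ {n} (σ : Permutation′ n) (x : Pt n) → sumℚ (x ∘ (σ ⟨$⟩ʳ_)) ≡ sumℚ x
sumℚ-permute σ x = trans (sumℚ≡sum (x ∘ (σ ⟨$⟩ʳ_))) (trans (sym (MonoidSumℚ.sum-permute x σ)) (sym (sumℚ≡sum x)))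
  where
  sumℚ≡sum : ∀ {n} (x : Pt n) → sumℚ x ≡ MonoidSumℚ.sum x
  sumℚ≡sum {zero} x = refl
  sumℚ≡sum {suc n} x = cong (x Fin.zero +_) (sumℚ≡sum (x ∘ Fin.suc))

dimℚ : ℕ → ℚ
dimℚ n = sumℚ {n} (λ _ → 1ℚ)

sumℚ-const : ∀ {n} c → sumℚ {n} (λ _ → c) ≡ c * dimℚ n
sumℚ-const {n} c = trans (sumℚ-cong {n} (λ _ → sym (ℚP.*-identityʳ c))) (sumℚ-* {n} c (λ _ → 1ℚ))

0<dimℚ : ∀ m → 0ℚ < dimℚ (suc m)
0<dimℚ m = ℚP.+-mono-<-≤ 0<1 (0≤dimℚ m)
  where
  0≤dimℚ : ∀ m → 0ℚ ≤ dimℚ m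
  0≤dimℚ zero = ℚP.≤-refl
  0≤dimℚ (suc m) = ℚP.+-mono-≤ (ℚP.<⇒≤ 0<1) (0≤dimℚ m)

module _ {m : ℕ} where
  private
    instance
      dim≢0 : ℚ.NonZero (dimℚ (suc m))
      dim≢0 = ℚP.pos⇒nonZero (dimℚ (suc m)) {{ℚ.positive (0<dimℚ m)}}

  centre : Pt (suc m) → Pt (suc m)
  centre u k = u k - sumℚ u * 1/ dimℚ (suc m)

  centre-InV : ∀ u → InV (centre u)
  centre-InV u = begin
    sumℚ (λ k → u k + - c)          ≡⟨ sumℚ-+ u (λ _ → - c) ⟩
    sumℚ u + sumℚ {suc m} (λ _ → - c) ≡⟨ cong (sumℚ u +_) (sumℚ-const {suc m} (- c)) ⟩
    sumℚ u + - c * d                 ≡⟨ cancel (sumℚ u) d (1/ d) ⟩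
    sumℚ u - sumℚ u * (d * 1/ d)     ≡⟨ cong (λ t → sumℚ u - sumℚ u * t) (ℚP.*-inverseʳ d) ⟩
    sumℚ u - sumℚ u * 1ℚ             ≡⟨ self-cancel (sumℚ u) ⟩
    0ℚ                               ∎
    where
    open ≡-Reasoning
    d = dimℚ (suc m)
    c = sumℚ u * 1/ d
    cancel : ∀ s d e → s + - (s * e) * d ≡ s - s * (d * e)
    cancel = solve-∀ ℚ-ring
    self-cancel : ∀ s → s - s * 1ℚ ≡ 0ℚ
    self-cancel = solve-∀ ℚ-ring

  pair-centre : ∀ u a b → pair (centre u) a b ≡ pair u a b
  pair-centre u a b = translate (u a) (u b) (sumℚ u * 1/ dimℚ (suc m))
    where
    translate : ∀ p q c → (p - c) - (q - c) ≡ p - q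
    translate = solve-∀ ℚ-ring

unit : ∀ {n} → Fin n → ℚ → Pt n
unit c v k = if does (k FinP.≟ c) then v else 0ℚ

unit-same : ∀ {n} (c : Fin n) v → unit c v c ≡ v
unit-same c v with c FinP.≟ c
... | yes _ = refl
... | no c≢c = contradiction refl c≢c

unit-other : ∀ {n} {c k : Fin n} v → k ≢ c → unit c v k ≡ 0ℚ
unit-other {c = c} {k} v k≢c with k FinP.≟ c
... | yes k≡c = contradiction k≡c k≢c
... | no _ = refl

∣unit∣≤∣v∣ : ∀ {n} (c k : Fin n) v → ∣ unit c v k ∣ ≤ ∣ v ∣
∣unit∣≤∣v∣ c k v with k FinP.≟ c
... | yes _ = ℚP.≤-refl
... | no _ = ℚP.0≤∣p∣ v

sumℚ-unit : ∀ {n} (c : Fin n) v → sumℚ (unit c v) ≡ v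
sumℚ-unit {suc n} Fin.zero v = trans (cong (v +_) (trans (sumℚ-const {n} 0ℚ) (ℚP.*-zeroˡ (dimℚ n)))) (ℚP.+-identityʳ v)
sumℚ-unit {suc n} (Fin.suc c) v = trans (ℚP.+-identityˡ _) (sumℚ-unit c v)

transfer : ∀ {n} → Fin n → Fin n → ℚ → Pt n → Pt n
transfer c d v x k = x k + unit c v k + unit d (- v) k

transfer-InV : ∀ {n} (c d : Fin n) v {x} → InV x → InV (transfer c d v x)
transfer-InV c d v {x} x∈V = begin
  sumℚ (λ k → x k + unit c v k + unit d (- v) k)            ≡⟨ sumℚ-+ (λ k → x k + unit c v k) (unit d (- v)) ⟩
  sumℚ (λ k → x k + unit c v k) + sumℚ (unit d (- v))      ≡⟨ cong₂ _+_ (sumℚ-+ x (unit c v)) (sumℚ-unit d (- v)) ⟩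
  sumℚ x + sumℚ (unit c v) + - v                           ≡⟨ cong (λ t → sumℚ x + t + - v) (sumℚ-unit c v) ⟩
  sumℚ x + v + - v                                         ≡⟨ cancel (sumℚ x) v ⟩
  sumℚ x                                                   ≡⟨ x∈V ⟩
  0ℚ                                                       ∎
  where
  open ≡-Reasoning
  cancel : ∀ s v → s + v + - v ≡ s
  cancel = solve-∀ ℚ-ring

transfer-to : ∀ {n} {c d : Fin n} v x → c ≢ d → transfer c d v x c ≡ x c + v
transfer-to {c = c} v x c≢d = trans (cong₂ (λ s t → x c + s + t) (unit-same c v) (unit-other (- v) c≢d)) (ℚP.+-identityʳ _)

transfer-from : ∀ {n} {c d : Fin n} v x → c ≢ d → transfer c d v x d ≡ x d - v
transfer-from {c = c} {d} v x c≢d =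
  trans (cong₂ (λ s t → x d + s + t) (unit-other v (c≢d ∘ sym)) (unit-same d (- v))) (cong (_- v) (ℚP.+-identityʳ (x d)))

transfer-other : ∀ {n} {c d k : Fin n} v x → k ≢ c → k ≢ d → transfer c d v x k ≡ x k
transfer-other {k = k} v x k≢c k≢d =
  trans (cong₂ (λ s t → x k + s + t) (unit-other v k≢c) (unit-other (- v) k≢d)) (trans (ℚP.+-identityʳ _) (ℚP.+-identityʳ (x k)))

pair-transfer : ∀ {n} {c d : Fin n} v x → c ≢ d → pair (transfer c d v x) c d ≡ pair x c d + (v + v)
pair-transfer {c = c} {d} v x c≢d = trans (cong₂ _-_ (transfer-to v x c≢d) (transfer-from v x c≢d)) (spread (x c) (x d) v)
  where
  spread : ∀ p q v → (p + v) - (q - v) ≡ (p - q) + (v + v)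
  spread = solve-∀ ℚ-ring

∣transfer-x∣≤2∣v∣ : ∀ {n} (c d : Fin n) v x k → ∣ transfer c d v x k - x k ∣ ≤ ∣ v ∣ + ∣ v ∣
∣transfer-x∣≤2∣v∣ c d v x k = begin
  ∣ transfer c d v x k - x k ∣              ≡⟨ cong ∣_∣ (increment (x k) (unit c v k) (unit d (- v) k)) ⟩
  ∣ unit c v k + unit d (- v) k ∣          ≤⟨ ℚP.∣p+q∣≤∣p∣+∣q∣ (unit c v k) (unit d (- v) k) ⟩
  ∣ unit c v k ∣ + ∣ unit d (- v) k ∣      ≤⟨ ℚP.+-mono-≤ (∣unit∣≤∣v∣ c k v) (∣unit∣≤∣v∣ d k (- v)) ⟩
  ∣ v ∣ + ∣ - v ∣                           ≡⟨ cong (∣ v ∣ +_) (ℚP.∣-p∣≡∣p∣ v) ⟩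
  ∣ v ∣ + ∣ v ∣                             ∎
  where
  open ℚP.≤-Reasoning
  increment : ∀ p s t → p + s + t - p ≡ s + t
  increment = solve-∀ ℚ-ring

transfer-near : ∀ {n r} (c d : Fin n) v x → ∣ v ∣ + ∣ v ∣ < r → Near r (transfer c d v x) x
transfer-near c d v x small k = ℚP.≤-<-trans (∣transfer-x∣≤2∣v∣ c d v x k) small

wiggle : ∀ {n} → Fin n → Fin n → Fin n → ℚ → Pt n → Pt n
wiggle c A B v x = transfer c A v (transfer c B v x)

module _ {n} {c A B : Fin n} (c≢A : c ≢ A) (c≢B : c ≢ B) (A≢B : A ≢ B) (v : ℚ) (x : Pt n) where

  wiggle-A : wiggle c A B v x A ≡ x A - v
  wiggle-A = trans (transfer-from v (transfer c B v x) c≢A) (cong (_- v) (transfer-other v x (c≢A ∘ sym) A≢B))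

  wiggle-B : wiggle c A B v x B ≡ x B - v
  wiggle-B = trans (transfer-other v (transfer c B v x) (c≢B ∘ sym) (A≢B ∘ sym)) (transfer-from v x c≢B)

  wiggle-c : wiggle c A B v x c ≡ x c + v + v
  wiggle-c = trans (transfer-to v (transfer c B v x) c≢A) (cong (_+ v) (transfer-to v x c≢B))

  pair-wiggle-AB : pair (wiggle c A B v x) A B ≡ pair x A B
  pair-wiggle-AB = trans (cong₂ _-_ wiggle-A wiggle-B) (shift (x A) (x B) v)
    where
    shift : ∀ p q v → (p - v) - (q - v) ≡ p - q
    shift = solve-∀ ℚ-ring

  pair-wiggle-Ac : pair (wiggle c A B v x) A c ≡ pair x A c - (v + v + v)
  pair-wiggle-Ac = trans (cong₂ _-_ wiggle-A wiggle-c) (shift (x A) (x c) v)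
    where
    shift : ∀ p q v → (p - v) - (q + v + v) ≡ (p - q) - (v + v + v)
    shift = solve-∀ ℚ-ring

  pair-wiggle-cB : pair (wiggle c A B v x) c B ≡ pair x c B + (v + v + v)
  pair-wiggle-cB = trans (cong₂ _-_ wiggle-c wiggle-B) (shift (x c) (x B) v)
    where
    shift : ∀ p q v → (p + v + v) - (q - v) ≡ (p - q) + (v + v + v)
    shift = solve-∀ ℚ-ring

conv : ∀ {n} → ℚ → Pt n → Pt n → Pt n
conv l x y k = (1ℚ - l) * x k + l * y k

conv-InV : ∀ {n} l {x y : Pt n} → InV x → InV y → InV (conv l x y)
conv-InV l {x} {y} x∈V y∈V = begin
  sumℚ (λ k → (1ℚ - l) * x k + l * y k)                 ≡⟨ sumℚ-+ (λ k → (1ℚ - l) * x k) (λ k → l * y k) ⟩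
  sumℚ (λ k → (1ℚ - l) * x k) + sumℚ (λ k → l * y k)   ≡⟨ cong₂ _+_ (sumℚ-* (1ℚ - l) x) (sumℚ-* l y) ⟩
  (1ℚ - l) * sumℚ x + l * sumℚ y                        ≡⟨ cong₂ (λ s t → (1ℚ - l) * s + l * t) x∈V y∈V ⟩
  (1ℚ - l) * 0ℚ + l * 0ℚ                                ≡⟨ vanish l ⟩
  0ℚ                                                    ∎
  where
  open ≡-Reasoning
  vanish : ∀ l → (1ℚ - l) * 0ℚ + l * 0ℚ ≡ 0ℚ
  vanish = solve-∀ ℚ-ring

pair-conv : ∀ {n} l (x y : Pt n) a b → pair (conv l x y) a b ≡ (1ℚ - l) * pair x a b + l * pair y a b
pair-conv l x y a b = distribute l (x a) (x b) (y a) (y b)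
  where
  distribute : ∀ l p q s t → ((1ℚ - l) * p + l * s) - ((1ℚ - l) * q + l * t) ≡ (1ℚ - l) * (p - q) + l * (s - t)
  distribute = solve-∀ ℚ-ring

stratum-unique : ∀ {s t q} → inStratum s q → inStratum t q → s ≡ t
stratum-unique {below}   {below}   _ _ = refl
stratum-unique {below}   {between} q<0 (0<q , _) = contradiction q<0 (ℚP.<-asym 0<q)
stratum-unique {below}   {above}   q<0 1<q = contradiction q<0 (ℚP.<-asym (ℚP.<-trans 0<1 1<q))
stratum-unique {between} {below}   (0<q , _) q<0 = contradiction q<0 (ℚP.<-asym 0<q)
stratum-unique {between} {between} _ _ = refl
stratum-unique {between} {above}   (_ , q<1) 1<q = contradiction q<1 (ℚP.<-asym 1<q)
stratum-unique {above}   {below}   1<q q<0 = contradiction q<0 (ℚP.<-asym (ℚP.<-trans 0<1 1<q))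
stratum-unique {above}   {between} 1<q (_ , q<1) = contradiction q<1 (ℚP.<-asym 1<q)
stratum-unique {above}   {above}   _ _ = refl

stratum-≢0 : ∀ t {q} → inStratum t q → q ≢ 0ℚ
stratum-≢0 below   q<0       refl = ℚP.<-irrefl refl q<0
stratum-≢0 between (0<q , _) refl = ℚP.<-irrefl refl 0<q
stratum-≢0 above   1<q       refl = ℚP.<-asym 0<1 1<q

stratum-≢1 : ∀ t {q} → inStratum t q → q ≢ 1ℚ
stratum-≢1 below   q<0       refl = ℚP.<-asym 0<1 q<0
stratum-≢1 between (_ , q<1) refl = ℚP.<-irrefl refl q<1
stratum-≢1 above   1<q       refl = ℚP.<-irrefl refl 1<q

stratum-pos : ∀ t {q q′} → inStratum t q → 0ℚ < q → inStratum t q′ → 0ℚ < q′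
stratum-pos below   q<0 0<q _          = contradiction q<0 (ℚP.<-asym 0<q)
stratum-pos between _   _   (0<q′ , _) = 0<q′
stratum-pos above   _   _   1<q′       = ℚP.<-trans 0<1 1<q′

stratum-neg : ∀ t {q q′} → inStratum t q → q < 0ℚ → inStratum t q′ → q′ < 0ℚ
stratum-neg below   _         _   q′<0 = q′<0
stratum-neg between (0<q , _) q<0 _    = contradiction q<0 (ℚP.<-asym 0<q)
stratum-neg above   1<q       q<0 _    = contradiction q<0 (ℚP.<-asym (ℚP.<-trans 0<1 1<q))

stratum-transfer : ∀ t {q q′} → (q < 0ℚ ⇔ q′ < 0ℚ) → (1ℚ < q ⇔ 1ℚ < q′) → q′ ≢ 0ℚ → q′ ≢ 1ℚ →
                   inStratum t q → inStratum t q′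
stratum-transfer below   neg _   _     _     q<0 = to neg q<0
stratum-transfer between neg one q′≢0 q′≢1 (0<q , q<1) =
    ≤∧≢⇒< (ℚP.≮⇒≥ (λ q′<0 → ℚP.<-asym 0<q (from neg q′<0))) (q′≢0 ∘ sym)
  , ≤∧≢⇒< (ℚP.≮⇒≥ (λ 1<q′ → ℚP.<-asym q<1 (from one 1<q′))) q′≢1
stratum-transfer above   _   one _     _     1<q = to one 1<q

<-convex : ∀ {l q₀ q₁ c} → 0ℚ < l → l < 1ℚ → q₀ < c → q₁ < c → (1ℚ - l) * q₀ + l * q₁ < c
<-convex {l} {q₀} {q₁} {c} 0<l l<1 q₀<c q₁<c =
  <-by-gap (+-pos (*-pos (p<q⇒0<q-p l<1) (p<q⇒0<q-p q₀<c)) (*-pos 0<l (p<q⇒0<q-p q₁<c))) (gap l q₀ q₁ c)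
  where
  gap : ∀ l q₀ q₁ c → (1ℚ - l) * (c - q₀) + l * (c - q₁) ≡ c - ((1ℚ - l) * q₀ + l * q₁)
  gap = solve-∀ ℚ-ring

>-convex : ∀ {l q₀ q₁ c} → 0ℚ < l → l < 1ℚ → c < q₀ → c < q₁ → c < (1ℚ - l) * q₀ + l * q₁
>-convex {l} {q₀} {q₁} {c} 0<l l<1 c<q₀ c<q₁ =
  <-by-gap (+-pos (*-pos (p<q⇒0<q-p l<1) (p<q⇒0<q-p c<q₀)) (*-pos 0<l (p<q⇒0<q-p c<q₁))) (gap l q₀ q₁ c)
  where
  gap : ∀ l q₀ q₁ c → (1ℚ - l) * (q₀ - c) + l * (q₁ - c) ≡ ((1ℚ - l) * q₀ + l * q₁) - c
  gap = solve-∀ ℚ-ring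

stratum-convex : ∀ t {l q₀ q₁} → 0ℚ < l → l < 1ℚ → inStratum t q₀ → inStratum t q₁ →
                 inStratum t ((1ℚ - l) * q₀ + l * q₁)
stratum-convex below   0<l l<1 q₀<0 q₁<0 = <-convex 0<l l<1 q₀<0 q₁<0
stratum-convex between 0<l l<1 (0<q₀ , q₀<1) (0<q₁ , q₁<1) = >-convex 0<l l<1 0<q₀ 0<q₁ , <-convex 0<l l<1 q₀<1 q₁<1
stratum-convex above   0<l l<1 1<q₀ 1<q₁ = >-convex 0<l l<1 1<q₀ 1<q₁

classify : ℚ → Side
classify q with q ℚP.<? 0ℚ | 1ℚ ℚP.<? q
... | yes _ | _     = below
... | no _  | yes _ = above
... | no _  | no _  = between

classify-correct : ∀ {q} → q ≢ 0ℚ → q ≢ 1ℚ → inStratum (classify q) q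
classify-correct {q} q≢0 q≢1 with q ℚP.<? 0ℚ | 1ℚ ℚP.<? q
... | yes q<0 | _     = q<0
... | no _    | yes 1<q = 1<q
... | no q≮0  | no 1≮q = ≤∧≢⇒< (ℚP.≮⇒≥ q≮0) (q≢0 ∘ sym) , ≤∧≢⇒< (ℚP.≮⇒≥ 1≮q) q≢1

Open : ∀ {n} → (Pt n → Set) → Pt n → Set
Open P w = ∃[ r ] (0ℚ < r × (∀ w′ → Near r w′ w → P w′))

Open-∀ : ∀ {n M} {P : Fin M → Pt n → Set} {w} → (∀ k → Open (P k) w) → Open (λ w′ → ∀ k → P k w′) w
Open-∀ {M = zero} _ = 1ℚ , 0<1 , λ _ _ ()
Open-∀ {M = suc M} {w = w} open-P with open-P Fin.zero | Open-∀ (open-P ∘ Fin.suc)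
... | r , 0<r , P₀ | s , 0<s , Pₛ = r ⊓ s , 0<⊓ 0<r 0<s , λ where
  w′ near Fin.zero    → P₀ w′ (λ k → ℚP.<-≤-trans (near k) (ℚP.p⊓q≤p r s))
  w′ near (Fin.suc k) → Pₛ w′ (λ k → ℚP.<-≤-trans (near k) (ℚP.p⊓q≤q r s)) k

Open-→ : ∀ {n} {A : Set} {P : Pt n → Set} {w} → Dec A → (A → Open P w) → Open (λ w′ → A → P w′) w
Open-→ (yes a) open-P with open-P a
... | r , 0<r , P-near = r , 0<r , λ w′ near _ → P-near w′ near
Open-→ (no ¬a) _ = 1ℚ , 0<1 , λ _ _ a → contradiction a ¬a

<-open : ∀ {q q′ c} → ∣ q′ - q ∣ < c - q → q′ < c
<-open {q} {q′} {c} near = <-by-gap (p<q⇒0<q-p (∣p-q∣<r⇒p-q<r {q′} {q} near)) (gap c q q′)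
  where
  gap : ∀ c q q′ → (c - q) - (q′ - q) ≡ c - q′
  gap = solve-∀ ℚ-ring

>-open : ∀ {q q′ c} → ∣ q′ - q ∣ < q - c → c < q′
>-open {q} {q′} {c} near = <-by-gap (p<q⇒0<q-p (∣p-q∣<r⇒q-p<r {q′} {q} near)) (gap c q q′)
  where
  gap : ∀ c q q′ → (q - c) - (q - q′) ≡ q′ - c
  gap = solve-∀ ℚ-ring

stratum-open : ∀ t {q} → inStratum t q → ∃[ r ] (0ℚ < r × (∀ {q′} → ∣ q′ - q ∣ < r → inStratum t q′))
stratum-open below   {q} q<0     = 0ℚ - q , p<q⇒0<q-p q<0 , <-open
stratum-open between {q} (0<q , q<1) = (q - 0ℚ) ⊓ (1ℚ - q) , 0<⊓ (p<q⇒0<q-p 0<q) (p<q⇒0<q-p q<1) ,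
  λ near → >-open (ℚP.<-≤-trans near (ℚP.p⊓q≤p (q - 0ℚ) (1ℚ - q))) , <-open (ℚP.<-≤-trans near (ℚP.p⊓q≤q (q - 0ℚ) (1ℚ - q)))
stratum-open above   {q} 1<q     = q - 1ℚ , p<q⇒0<q-p 1<q , >-open

pair-open : ∀ {n} t (w : Pt n) a b → inStratum t (pair w a b) → Open (λ w′ → inStratum t (pair w′ a b)) w
pair-open t w a b w∈t with stratum-open t w∈t
... | r , 0<r , t-near = ½ * r , ½*-pos 0<r ,
  λ w′ near → t-near (subst (∣ pair w′ a b - pair w a b ∣ <_) (halves r) (pair-near {x = w′} {w} near a b))

-- Regions and chambers

module _ {n : ℕ} where

  signs : Region n → SignVec n
  signs = proj₁

  sample : Region n → Pt n
  sample R = proj₁ (proj₂ R)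

  sample∈R : (R : Region n) → sample R ∈R R
  sample∈R R = proj₂ (proj₂ R)

  region-order : (R : Region n) {x y : Pt n} → x ∈R R → y ∈R R → ∀ {c d} → x d < x c → y d < y c
  region-order (s , _) (_ , x∈) (_ , y∈) {c} {d} xd<xc with FinP.<-cmp c d
  ... | tri< c<d _ _ = 0<q-p⇒p<q (stratum-pos (s c d) (x∈ c d c<d) (p<q⇒0<q-p xd<xc) (y∈ c d c<d))
  ... | tri≈ _ refl _ = contradiction xd<xc (ℚP.<-irrefl refl)
  ... | tri> _ _ d<c = p-q<0⇒p<q (stratum-neg (s d c) (x∈ d c d<c) (p<q⇒p-q<0 xd<xc) (y∈ d c d<c))

  region-injective : (R : Region n) {x : Pt n} → x ∈R R → ∀ {c d} → x c ≡ x d → c ≡ d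
  region-injective (s , _) (_ , x∈) {c} {d} xc≡xd with FinP.<-cmp c d
  ... | tri< c<d _ _ = contradiction (p≡q⇒p-q≡0 xc≡xd) (stratum-≢0 (s c d) (x∈ c d c<d))
  ... | tri≈ _ c≡d _ = c≡d
  ... | tri> _ _ d<c = contradiction (p≡q⇒p-q≡0 (sym xc≡xd)) (stratum-≢0 (s d c) (x∈ d c d<c))

regionAt : ∀ {n} (x : Pt n) → InV x → (∀ {a b} → a Fin.< b → ∃[ t ] inStratum t (pair x a b)) → Region n
regionAt x x∈V stratified = (λ a b → classify (pair x a b)) , x , x∈V ,
  λ a b a<b → let (t , x∈t) = stratified a<b in classify-correct (stratum-≢0 t x∈t) (stratum-≢1 t x∈t)

closure-≥ : ∀ {n} (R : Region n) {κ c d} → (∀ y → y ∈R R → κ < pair y c d) → ∀ z → InClosure R z → κ ≤ pair z c d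
closure-≥ R {κ} {c} {d} κ<R z z∈R̄ = ℚP.≮⇒≥ λ z<κ →
  let (y , y∈R , near) = z∈R̄ (½ * (κ - pair z c d)) (½*-pos (p<q⇒0<q-p z<κ))
  in ℚP.<-asym (κ<R y y∈R)
       (<-by-gap (p<q⇒0<q-p (∣p-q∣<r⇒q-p<r {pair z c d} {pair y c d} (pair-near {x = z} {y} near c d)))
                 (gap κ (pair z c d) (pair y c d)))
  where
  gap : ∀ κ p q → (½ * (κ - p) + ½ * (κ - p)) - (q - p) ≡ κ - q
  gap = solve-∀ ℚ-ring

CellExcept : ∀ {n} → SignVec n → Fin n → Fin n → Pt n → Set
CellExcept s A B x = ∀ a b → a Fin.< b → (a , b) ≢ (A , B) → inStratum (s a b) (pair x a b)

_≟²_ : ∀ {n} (p q : Fin n × Fin n) → Dec (p ≡ q)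
_≟²_ = ≡-dec FinP._≟_ FinP._≟_

CellExcept-open : ∀ {n} (s : SignVec n) A B {w} → CellExcept s A B w → Open (CellExcept s A B) w
CellExcept-open s A B {w} w∈ =
  Open-∀ {P = λ a w′ → ∀ b → a Fin.< b → (a , b) ≢ (A , B) → inStratum (s a b) (pair w′ a b)} λ a →
  Open-∀ {P = λ b w′ → a Fin.< b → (a , b) ≢ (A , B) → inStratum (s a b) (pair w′ a b)} λ b →
  Open-→ (a FinP.<? b) λ a<b → Open-→ (¬? ((a , b) ≟² (A , B))) λ ab≢AB → pair-open (s a b) w a b (w∈ a b a<b ab≢AB)

cell-from-except : ∀ {n} (R : Region n) {A B x} → InV x → CellExcept (signs R) A B x →
                   inStratum (signs R A B) (pair x A B) → x ∈R R
cell-from-except R {A} {B} {x} x∈V except at-AB = x∈V , stratum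
  where
  stratum : ∀ a b → a Fin.< b → inStratum (signs R a b) (pair x a b)
  stratum a b a<b with (a , b) ≟² (A , B)
  ... | yes refl = at-AB
  ... | no ab≢AB = except a b a<b ab≢AB

injective⇒surjective : ∀ {n} (f : Fin n → Fin n) → (∀ {i j} → f i ≡ f j → i ≡ j) → ∀ y → ∃[ x ] f x ≡ y
injective⇒surjective {suc m} f f-inj y with FinP.any? (λ x → f x FinP.≟ y)
... | yes hit = hit
... | no miss = contradiction (FinP.injective⇒≤ g-injective) ℕP.1+n≰n
  where
  g : Fin (suc m) → Fin m
  g x = Fin.punchOut {i = y} (λ y≡fx → miss (x , sym y≡fx))
  g-injective : ∀ {x x′} → g x ≡ g x′ → x ≡ x′
  g-injective {x} {x′} = f-inj ∘ FinP.punchOut-injective (λ y≡fx → miss (x , sym y≡fx)) (λ y≡fx′ → miss (x′ , sym y≡fx′))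

SortedBy : ∀ {n} → Permutation′ n → Pt n → Set
SortedBy σ x = ∀ {i j} → i Fin.< j → x (σ ⟨$⟩ʳ j) < x (σ ⟨$⟩ʳ i)

module Ranking {n} (x : Pt n) (x-injective : ∀ {c d} → x c ≡ x d → c ≡ d) where

  strictlyAbove : Fin n → Subset.Subset n
  strictlyAbove c = Vec.tabulate (λ d → if does (x c ℚP.<? x d) then Subset.inside else Subset.outside)

  ∈-strictlyAbove⁺ : ∀ {c d} → x c < x d → d Subset.∈ strictlyAbove c
  ∈-strictlyAbove⁺ {c} {d} xc<xd = VecP.lookup⇒[]= d (strictlyAbove c)
    (trans (VecP.lookup∘tabulate _ d) (cong (if_then Subset.inside else Subset.outside) (dec-true (x c ℚP.<? x d) xc<xd)))

  ∈-strictlyAbove⁻ : ∀ {c d} → d Subset.∈ strictlyAbove c → x c < x d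
  ∈-strictlyAbove⁻ {c} {d} d∈ = chosen (x c ℚP.<? x d) (trans (sym (VecP.lookup∘tabulate _ d)) (VecP.[]=⇒lookup d∈))
    where
    chosen : ∀ {A : Set} (a? : Dec A) → (if does a? then Subset.inside else Subset.outside) ≡ Subset.inside → A
    chosen (yes a) _ = a

  rankℕ : Fin n → ℕ
  rankℕ c = Subset.∣ strictlyAbove c ∣

  rank<n : ∀ c → rankℕ c ℕ.< n
  rank<n c = subst (rankℕ c ℕ.<_) (SubsetP.∣⊤∣≡n n)
    (SubsetP.p⊂q⇒∣p∣<∣q∣ (SubsetP.⊆⊤ , c , SubsetP.∈⊤ , λ c∈ → ℚP.<-irrefl refl (∈-strictlyAbove⁻ c∈)))

  rank-anti : ∀ {c d} → x c < x d → rankℕ d ℕ.< rankℕ c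
  rank-anti {c} {d} xc<xd = SubsetP.p⊂q⇒∣p∣<∣q∣
    ( (λ e∈ → ∈-strictlyAbove⁺ (ℚP.<-trans xc<xd (∈-strictlyAbove⁻ e∈)))
    , d , ∈-strictlyAbove⁺ xc<xd , λ d∈ → ℚP.<-irrefl refl (∈-strictlyAbove⁻ d∈))

  rank : Fin n → Fin n
  rank c = fromℕ< (rank<n c)

  toℕ-rank : ∀ c → toℕ (rank c) ≡ rankℕ c
  toℕ-rank c = FinP.toℕ-fromℕ< (rank<n c)

  rank-injective : ∀ {c d} → rank c ≡ rank d → c ≡ d
  rank-injective {c} {d} rc≡rd with ℚP.<-cmp (x c) (x d)
  ... | tri< xc<xd _ _ = contradiction (rank-anti xc<xd) (ℕP.<-irrefl (sym rankℕ≡))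
    where rankℕ≡ = trans (sym (toℕ-rank c)) (trans (cong toℕ rc≡rd) (toℕ-rank d))
  ... | tri≈ _ xc≡xd _ = x-injective xc≡xd
  ... | tri> _ _ xd<xc = contradiction (rank-anti xd<xc) (ℕP.<-irrefl rankℕ≡)
    where rankℕ≡ = trans (sym (toℕ-rank c)) (trans (cong toℕ rc≡rd) (toℕ-rank d))

  unrank : Fin n → Fin n
  unrank i = proj₁ (injective⇒surjective rank rank-injective i)

  rank-unrank : ∀ i → rank (unrank i) ≡ i
  rank-unrank i = proj₂ (injective⇒surjective rank rank-injective i)

  sorter : Permutation′ n
  sorter = permutation unrank rank (λ c → rank-injective (rank-unrank (rank c))) rank-unrank

  sorter-sorts : SortedBy sorter x
  sorter-sorts {i} {j} i<j with ℚP.<-cmp (x (unrank i)) (x (unrank j))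
  ... | tri< xi<xj _ _ = contradiction (subst₂ ℕ._<_ (ranked j) (ranked i) (rank-anti xi<xj)) (ℕP.<-asym i<j)
    where ranked : ∀ k → rankℕ (unrank k) ≡ toℕ k
          ranked k = trans (sym (toℕ-rank (unrank k))) (cong toℕ (rank-unrank k))
  ... | tri≈ _ xi≡xj _ =
    contradiction (cong toℕ (trans (sym (rank-unrank i)) (trans (cong rank (x-injective xi≡xj)) (rank-unrank j)))) (ℕP.<⇒≢ i<j)
  ... | tri> _ _ xj<xi = xj<xi

⟨$⟩ʳ-injective : ∀ {n} (σ : Permutation′ n) {i j} → σ ⟨$⟩ʳ i ≡ σ ⟨$⟩ʳ j → i ≡ j
⟨$⟩ʳ-injective σ e = trans (sym (inverseˡ σ)) (trans (cong (σ ⟨$⟩ˡ_) e) (inverseˡ σ))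

⟨$⟩ˡ-injective : ∀ {n} (σ : Permutation′ n) {a b} → σ ⟨$⟩ˡ a ≡ σ ⟨$⟩ˡ b → a ≡ b
⟨$⟩ˡ-injective σ e = trans (sym (inverseʳ σ)) (trans (cong (σ ⟨$⟩ʳ_) e) (inverseʳ σ))

strictlyIncreasing⇒≥ : ∀ {n} (f : Fin n → Fin n) → (∀ {i j} → i Fin.< j → f i Fin.< f j) → ∀ i → i Fin.≤ f i
strictlyIncreasing⇒≥ {n} f f-inc i =
  subst (λ k → toℕ i ℕ.≤ toℕ (f k)) (FinP.fromℕ<-toℕ i (FinP.toℕ<n i)) (go (toℕ i) (FinP.toℕ<n i))
  where
  go : ∀ k (k<n : k ℕ.< n) → k ℕ.≤ toℕ (f (fromℕ< k<n))
  go zero _ = z≤n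
  go (suc k) k+1<n = ℕP.≤-<-trans (go k k<n)
    (f-inc (subst₂ ℕ._<_ (sym (FinP.toℕ-fromℕ< k<n)) (sym (FinP.toℕ-fromℕ< k+1<n)) (ℕP.n<1+n k)))
    where
    k<n : k ℕ.< n
    k<n = ℕP.<-trans (ℕP.n<1+n k) k+1<n

sorted⁻¹ : ∀ {n} {σ : Permutation′ n} {x} → SortedBy σ x → ∀ {a b} → σ ⟨$⟩ˡ a Fin.< σ ⟨$⟩ˡ b → x b < x a
sorted⁻¹ {σ = σ} {x} sorts lt = subst₂ (λ c d → x c < x d) (inverseʳ σ) (inverseʳ σ) (sorts lt)

sorted-index< : ∀ {n} {σ : Permutation′ n} {x} → SortedBy σ x → ∀ {i j} → x (σ ⟨$⟩ʳ j) < x (σ ⟨$⟩ʳ i) → i Fin.< j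
sorted-index< sorts {i} {j} lt with FinP.<-cmp i j
... | tri< i<j _ _ = i<j
... | tri≈ _ refl _ = contradiction lt (ℚP.<-irrefl refl)
... | tri> _ _ j<i = contradiction (sorts j<i) (ℚP.<-asym lt)

sorted-unique : ∀ {n} {σ τ : Permutation′ n} {x} → SortedBy σ x → SortedBy τ x → ∀ i → σ ⟨$⟩ʳ i ≡ τ ⟨$⟩ʳ i
sorted-unique {σ = σ} {τ} {x} σ-sorts τ-sorts i = trans (sym (inverseʳ τ)) (cong (τ ⟨$⟩ʳ_) φi≡i)
  where
  relabel : ∀ {σ τ : Permutation′ _} → SortedBy σ x → SortedBy τ x → ∀ {i j} → i Fin.< j → τ ⟨$⟩ˡ (σ ⟨$⟩ʳ i) Fin.< τ ⟨$⟩ˡ (σ ⟨$⟩ʳ j)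
  relabel {σ} {τ} σ-sorts τ-sorts {i} {j} i<j with FinP.<-cmp (τ ⟨$⟩ˡ (σ ⟨$⟩ʳ i)) (τ ⟨$⟩ˡ (σ ⟨$⟩ʳ j))
  ... | tri< lt _ _ = lt
  ... | tri≈ _ eq _ = contradiction (cong toℕ (⟨$⟩ʳ-injective σ (⟨$⟩ˡ-injective τ eq))) (ℕP.<⇒≢ i<j)
  ... | tri> _ _ gt = contradiction (sorted⁻¹ {σ = τ} {x} τ-sorts gt) (ℚP.<-asym (σ-sorts i<j))
  φ = λ k → τ ⟨$⟩ˡ (σ ⟨$⟩ʳ k)
  ψ = λ k → σ ⟨$⟩ˡ (τ ⟨$⟩ʳ k)
  φi≡i : φ i ≡ i
  φi≡i = FinP.toℕ-injective (ℕP.≤-antisym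
    (subst (λ k → toℕ (φ i) ℕ.≤ toℕ k) (trans (cong (σ ⟨$⟩ˡ_) (inverseʳ τ)) (inverseˡ σ))
       (strictlyIncreasing⇒≥ ψ (relabel {τ} {σ} τ-sorts σ-sorts) (φ i)))
    (strictlyIncreasing⇒≥ φ (relabel {σ} {τ} σ-sorts τ-sorts) i))

sorted-≤ : ∀ {n} {σ : Permutation′ n} {x} → SortedBy σ x → ∀ {i j} → i Fin.≤ j → x (σ ⟨$⟩ʳ j) ≤ x (σ ⟨$⟩ʳ i)
sorted-≤ {σ = σ} {x} sorts {i} {j} i≤j with ℕP.m≤n⇒m<n∨m≡n i≤j
... | inj₁ i<j = ℚP.<⇒≤ (sorts i<j)
... | inj₂ i≡j = ℚP.≤-reflexive (cong (λ k → x (σ ⟨$⟩ʳ k)) (sym (FinP.toℕ-injective i≡j)))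

sorted-order : ∀ {n} {σ : Permutation′ n} {x y} → SortedBy σ x → SortedBy σ y → ∀ {a b} → x a < x b → y a < y b
sorted-order {σ = σ} {x} {y} x-sorts y-sorts {a} {b} xa<xb with FinP.<-cmp (σ ⟨$⟩ˡ a) (σ ⟨$⟩ˡ b)
... | tri< lt _ _ = contradiction (sorted⁻¹ {σ = σ} {x} x-sorts lt) (ℚP.<-asym xa<xb)
... | tri≈ _ eq _ = contradiction (subst (λ c → x a < x c) (⟨$⟩ˡ-injective σ (sym eq)) xa<xb) (ℚP.<-irrefl refl)
... | tri> _ _ gt = sorted⁻¹ {σ = σ} {y} y-sorts gt

sorted⇒InWC : ∀ {n} {σ : Permutation′ n} {x} → InV x → SortedBy σ x → InWC σ x
sorted⇒InWC {σ = σ} {x} x∈V sorts =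
  (λ i → x (σ ⟨$⟩ʳ i)) , (trans (sumℚ-permute σ x) x∈V , λ i j i<j → p<q⇒0<q-p (sorts i<j)) , λ k → cong x (sym (inverseʳ σ))

InWC⇒sorted : ∀ {n} {σ : Permutation′ n} {x} → InWC σ x → SortedBy σ x
InWC⇒sorted {σ = σ} {x} (y , (_ , y-decreasing) , x≡σy) {i} {j} i<j =
  subst₂ _<_ (sym (at j)) (sym (at i)) (0<q-p⇒p<q (y-decreasing i j i<j))
  where
  at : ∀ k → x (σ ⟨$⟩ʳ k) ≡ y k
  at k = trans (x≡σy _) (cong y (inverseˡ σ))

InChamber : ∀ {n} → Permutation′ n → Region n → Set
InChamber σ R = SortedBy σ (sample R)

chamber-sorts : ∀ {n} {σ} (R : Region n) → InChamber σ R → ∀ {x} → x ∈R R → SortedBy σ x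
chamber-sorts R R⊆σC x∈R i<j = region-order R (sample∈R R) x∈R (R⊆σC i<j)

chamberOf : ∀ {n} (R : Region n) → ∃[ σ ] InChamber σ R
chamberOf R = Ranking.sorter (sample R) x-injective , Ranking.sorter-sorts (sample R) x-injective
  where
  x-injective = region-injective R (sample∈R R)

Above : ∀ {n} → Permutation′ n → Pt n → Fin n → Fin n → Set
Above σ x i j = i Fin.< j × σ ⟨$⟩ʳ i Fin.< σ ⟨$⟩ʳ j × 1ℚ < pair x (σ ⟨$⟩ʳ i) (σ ⟨$⟩ʳ j)

above? : ∀ {n} σ (x : Pt n) i j → Dec (Above σ x i j)
above? σ x i j = i FinP.<? j ×-dec (σ ⟨$⟩ʳ i FinP.<? σ ⟨$⟩ʳ j ×-dec 1ℚ ℚP.<? pair x (σ ⟨$⟩ʳ i) (σ ⟨$⟩ʳ j))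

Above-nested : ∀ {n} {σ : Permutation′ n} {x i j i′ j′} → SortedBy σ x → Above σ x i′ j′ →
               i Fin.≤ i′ → j′ Fin.≤ j → σ ⟨$⟩ʳ i Fin.< σ ⟨$⟩ʳ j → Above σ x i j
Above-nested {σ = σ} {x} sorts (i′<j′ , _ , 1<x′) i≤i′ j′≤j σi<σj =
    ℕP.≤-<-trans i≤i′ (ℕP.<-≤-trans i′<j′ j′≤j)
  , σi<σj
  , ℚP.<-≤-trans 1<x′ (ℚP.+-mono-≤ (sorted-≤ {σ = σ} {x} sorts i≤i′) (ℚP.neg-antimono-≤ (sorted-≤ {σ = σ} {x} sorts j′≤j)))

Above-region : ∀ {n} {σ : Permutation′ n} (R : Region n) {x y i j} → x ∈R R → y ∈R R → Above σ x i j → Above σ y i j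
Above-region {σ = σ} (s , _) {x} {y} {i} {j} (_ , x∈) (_ , y∈) (i<j , σi<σj , 1<x) =
  i<j , σi<σj , subst (λ t → inStratum t (pair y a b)) (stratum-unique {s a b} {above} (x∈ a b σi<σj) 1<x) (y∈ a b σi<σj)
  where
  a = σ ⟨$⟩ʳ i
  b = σ ⟨$⟩ʳ j

above⇔pair : ∀ {n} {σ : Permutation′ n} {x} → SortedBy σ x → ∀ {a b} → a Fin.< b →
             Above σ x (σ ⟨$⟩ˡ a) (σ ⟨$⟩ˡ b) ⇔ 1ℚ < pair x a b
above⇔pair {σ = σ} {x} sorts {a} {b} a<b = mk⇔ (λ (_ , _ , 1<x) → subst₂ (λ c d → 1ℚ < pair x c d) (inverseʳ σ) (inverseʳ σ) 1<x) ⇐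
  where
  ⇐ : 1ℚ < pair x a b → Above σ x (σ ⟨$⟩ˡ a) (σ ⟨$⟩ˡ b)
  ⇐ 1<x with FinP.<-cmp (σ ⟨$⟩ˡ a) (σ ⟨$⟩ˡ b)
  ... | tri< i<j _ _ = i<j , subst₂ Fin._<_ (sym (inverseʳ σ)) (sym (inverseʳ σ)) a<b ,
                       subst₂ (λ c d → 1ℚ < pair x c d) (sym (inverseʳ σ)) (sym (inverseʳ σ)) 1<x
  ... | tri≈ _ i≡j _ = contradiction (cong toℕ (⟨$⟩ˡ-injective σ i≡j)) (ℕP.<⇒≢ a<b)
  ... | tri> _ _ j<i = contradiction (sorted⁻¹ {σ = σ} {x} sorts j<i) (ℚP.<-asym (0<q-p⇒p<q (ℚP.<-trans 0<1 1<x)))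

chamber-stratum : ∀ {n} {σ : Permutation′ n} (R : Region n) → InChamber σ R → ∀ {x} → SortedBy σ x →
                  ∀ {a b} → a Fin.< b → pair x a b ≢ 0ℚ → pair x a b ≢ 1ℚ →
                  (Above σ (sample R) (σ ⟨$⟩ˡ a) (σ ⟨$⟩ˡ b) ⇔ Above σ x (σ ⟨$⟩ˡ a) (σ ⟨$⟩ˡ b)) →
                  inStratum (signs R a b) (pair x a b)
chamber-stratum {σ = σ} R R⊆σC {x} x-sorts {a} {b} a<b x≢0 x≢1 same-above =
  stratum-transfer (signs R a b) (mk⇔ (neg {sample R} {x} R⊆σC x-sorts) (neg {x} {sample R} x-sorts R⊆σC)) one x≢0 x≢1
    (proj₂ (sample∈R R) a b a<b)
  where
  neg : ∀ {y z} → SortedBy σ y → SortedBy σ z → pair y a b < 0ℚ → pair z a b < 0ℚ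
  neg {y} {z} y-sorts z-sorts y<0 = p<q⇒p-q<0 (sorted-order {σ = σ} {y} {z} y-sorts z-sorts (p-q<0⇒p<q y<0))
  one : 1ℚ < pair (sample R) a b ⇔ 1ℚ < pair x a b
  one = mk⇔ (λ 1<s → to (above⇔pair {σ = σ} {x} x-sorts a<b) (to same-above (from (above⇔pair {σ = σ} {sample R} R⊆σC a<b) 1<s)))
            (λ 1<x → to (above⇔pair {σ = σ} {sample R} R⊆σC a<b) (from same-above (from (above⇔pair {σ = σ} {x} x-sorts a<b) 1<x)))

-- Realising a nesting-closed set of pairs

NestingClosed : ∀ {n} → (Fin n → Fin n → Set) → Set
NestingClosed B = ∀ {k l k′ l′} → B k l → k′ Fin.≤ k → l Fin.≤ l′ → B k′ l′

Realises : ∀ {n} → (Fin n → Fin n → Set) → (Fin n → ℚ) → Set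
Realises B y = ∀ {k l} → k Fin.< l → y l < y k × (B k l → 1ℚ < y k - y l) × (¬ B k l → y k - y l < 1ℚ)

-- Every bound imposed on the new first coordinate by y′ lies on the correct side of every other, so interpolation finds it.
realise-head : ∀ {m} {B : Fin (suc m) → Fin (suc m) → Set} → (∀ k l → Dec (B k l)) → NestingClosed B →
               ∀ {y′ : Fin m → ℚ} → Realises (λ k l → B (Fin.suc k) (Fin.suc l)) y′ →
               ∃[ y₀ ] (∀ l → y′ l < y₀ × (B Fin.zero (Fin.suc l) → 1ℚ < y₀ - y′ l) × (¬ B Fin.zero (Fin.suc l) → y₀ - y′ l < 1ℚ))
realise-head {m} {B} B? closed {y′} y′-realises = y₀ , λ l →
    L<y₀ (∈-++⁺ˡ (∈-map⁺ y′ (∈-allFin l)))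
  , (λ b → q+r<p⇒r<p-q (L<y₀ (∈-++⁺ʳ (map y′ (allFin m)) (∈-map∘filter⁺ y′+1 B₀? (l , ∈-allFin l , refl , b)))))
  , (λ ¬b → p<q+r⇒p-q<r (y₀<U (∈-map∘filter⁺ y′+1 ¬B₀? (l , ∈-allFin l , refl , ¬b))))
  where
  y′-≤ : ∀ {k l} → k Fin.≤ l → y′ l ≤ y′ k
  y′-≤ {k} {l} k≤l with ℕP.m≤n⇒m<n∨m≡n k≤l
  ... | inj₁ k<l = ℚP.<⇒≤ (proj₁ (y′-realises k<l))
  ... | inj₂ k≡l = ℚP.≤-reflexive (cong y′ (sym (FinP.toℕ-injective k≡l)))
  B₀ : Fin m → Set
  B₀ l = B Fin.zero (Fin.suc l)
  B₀? : ∀ l → Dec (B₀ l)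
  B₀? l = B? Fin.zero (Fin.suc l)
  ¬B₀? : ∀ l → Dec (¬ B₀ l)
  ¬B₀? l = ¬? (B₀? l)
  y′+1 : Fin m → ℚ
  y′+1 l = y′ l + 1ℚ
  L U : List ℚ
  L = map y′ (allFin m) ++ map y′+1 (filter B₀? (allFin m))
  U = map y′+1 (filter ¬B₀? (allFin m))
  below-unbounded : ∀ l {l′} → ¬ B₀ l′ → y′ l < y′ l′ + 1ℚ
  below-unbounded l {l′} ¬b′ with FinP.<-cmp l l′
  ... | tri< l<l′ _ _ = p-q<r⇒p<q+r (proj₂ (proj₂ (y′-realises l<l′)) (λ b → ¬b′ (closed b z≤n ℕP.≤-refl)))
  ... | tri≈ _ refl _ = q<q+1 _
  ... | tri> _ _ l′<l = ℚP.≤-<-trans (y′-≤ (ℕP.<⇒≤ l′<l)) (q<q+1 _)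
  bounded-unbounded : ∀ {l l′} → B₀ l → ¬ B₀ l′ → y′ l + 1ℚ < y′ l′ + 1ℚ
  bounded-unbounded {l} {l′} b ¬b′ with FinP.<-cmp l′ l
  ... | tri< l′<l _ _ = ℚP.+-monoˡ-< 1ℚ (proj₁ (y′-realises l′<l))
  ... | tri≈ _ refl _ = contradiction b ¬b′
  ... | tri> _ _ l<l′ = contradiction (closed b ℕP.≤-refl (ℕP.<⇒≤ (s≤s l<l′))) ¬b′
  separated : ∀ {p q} → p ∈ L → q ∈ U → p < q
  separated p∈L q∈U with ∈-map∘filter⁻ y′+1 ¬B₀? {xs = allFin m} q∈U
  ... | l′ , _ , refl , ¬b′ with ∈-++⁻ (map y′ (allFin m)) p∈L
  ...   | inj₁ p∈ with ∈-map⁻ y′ p∈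
  ...     | l , _ , refl = below-unbounded l ¬b′
  separated p∈L q∈U | l′ , _ , refl , ¬b′ | inj₂ p∈ with ∈-map∘filter⁻ y′+1 B₀? {xs = allFin m} p∈
  ...     | l , _ , refl , b = bounded-unbounded b ¬b′
  y₀ = proj₁ (interpolate L U separated)
  L<y₀ = proj₁ (proj₂ (interpolate L U separated))
  y₀<U = proj₂ (proj₂ (interpolate L U separated))

realise : ∀ n {B : Fin n → Fin n → Set} → (∀ k l → Dec (B k l)) → NestingClosed B → ∃[ y ] Realises B y
realise zero _ _ = (λ ()) , λ {k} → ⊥-elim (FinP.¬Fin0 k)
realise (suc m) {B} B? closed = y , realises
  where
  rest = realise m (λ k l → B? (Fin.suc k) (Fin.suc l)) (λ b k′≤k l≤l′ → closed b (s≤s k′≤k) (s≤s l≤l′))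
  head = realise-head B? closed (proj₂ rest)
  y : Fin (suc m) → ℚ
  y Fin.zero = proj₁ head
  y (Fin.suc k) = proj₁ rest k
  realises : Realises B y
  realises {Fin.zero} {Fin.suc l} _ = proj₂ head l
  realises {Fin.suc k} {Fin.suc l} (s≤s k<l) = proj₂ rest k<l

module Realised {m} (σ : Permutation′ (suc m)) {B : Fin (suc m) → Fin (suc m) → Set}
                (B? : ∀ k l → Dec (B k l)) (closed : NestingClosed B) where

  private
    y : Fin (suc m) → ℚ
    y = proj₁ (realise (suc m) B? closed)
    y-realises : Realises B y
    y-realises = proj₂ (realise (suc m) B? closed)

  point : Pt (suc m)
  point = centre (act σ y)

  pair-point : ∀ i j → pair point (σ ⟨$⟩ʳ i) (σ ⟨$⟩ʳ j) ≡ y i - y j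
  pair-point i j = trans (pair-centre (act σ y) (σ ⟨$⟩ʳ i) (σ ⟨$⟩ʳ j)) (cong₂ (λ s t → y s - y t) (inverseˡ σ {i}) (inverseˡ σ {j}))

  point-sorted : SortedBy σ point
  point-sorted {i} {j} i<j = 0<q-p⇒p<q (subst (0ℚ <_) (sym (pair-point i j)) (p<q⇒0<q-p (proj₁ (y-realises i<j))))

  point-stratified : ∀ {a b} → a Fin.< b → ∃[ t ] inStratum t (pair point a b)
  point-stratified {a} {b} a<b with FinP.<-cmp (σ ⟨$⟩ˡ a) (σ ⟨$⟩ˡ b)
  ... | tri< i<j _ _ = stratum-of (B? _ _)
    where
    realised = y-realises i<j
    pair≡ : y (σ ⟨$⟩ˡ a) - y (σ ⟨$⟩ˡ b) ≡ pair point a b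
    pair≡ = trans (sym (pair-point _ _)) (cong₂ (pair point) (inverseʳ σ) (inverseʳ σ))
    stratum-of : Dec (B (σ ⟨$⟩ˡ a) (σ ⟨$⟩ˡ b)) → ∃[ t ] inStratum t (pair point a b)
    stratum-of (yes b) = above , subst (1ℚ <_) pair≡ (proj₁ (proj₂ realised) b)
    stratum-of (no ¬b) = between , subst (0ℚ <_) pair≡ (p<q⇒0<q-p (proj₁ realised)) , subst (_< 1ℚ) pair≡ (proj₂ (proj₂ realised) ¬b)
  ... | tri≈ _ i≡j _ = contradiction (cong toℕ (⟨$⟩ˡ-injective σ i≡j)) (ℕP.<⇒≢ a<b)
  ... | tri> _ _ j<i = below , p<q⇒p-q<0 (sorted⁻¹ {σ = σ} {point} point-sorted j<i)

  point-InV : InV point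
  point-InV = centre-InV (act σ y)

  region : Region (suc m)
  region = regionAt point point-InV point-stratified

  region-chamber : InChamber σ region
  region-chamber = point-sorted

  Above⇔B : ∀ {i j} → i Fin.< j → σ ⟨$⟩ʳ i Fin.< σ ⟨$⟩ʳ j → Above σ point i j ⇔ B i j
  Above⇔B {i} {j} i<j σi<σj = mk⇔ ⇒ (λ b → i<j , σi<σj , subst (1ℚ <_) (sym (pair-point i j)) (proj₁ (proj₂ (y-realises i<j)) b))
    where
    ⇒ : Above σ point i j → B i j
    ⇒ (_ , _ , 1<pair) with B? i j
    ... | yes b = b
    ... | no ¬b = contradiction (subst (1ℚ <_) (pair-point i j) 1<pair) (ℚP.<-asym (proj₂ (proj₂ (y-realises i<j)) ¬b))

-- Minimal pairs and height functions

Minimal : ∀ {n} → (Fin n → Fin n → Set) → Fin n → Fin n → Set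
Minimal A i j = A i j × (∀ {i′ j′} → A i′ j′ → i Fin.≤ i′ → j′ Fin.≤ j → i′ ≡ i × j′ ≡ j)

Minimal-cong : ∀ {n} {A A′ : Fin n → Fin n → Set} → (∀ {i j} → A i j ⇔ A′ i j) → ∀ {i j} → Minimal A i j ⇔ Minimal A′ i j
Minimal-cong A⇔A′ = mk⇔ (λ (a , min) → to A⇔A′ a , min ∘ from A⇔A′)
                         (λ (a′ , min′) → from A⇔A′ a′ , min′ ∘ to A⇔A′)

nested-width< : ∀ {n} {k l i j : Fin n} → k Fin.≤ i → i Fin.< j → j Fin.≤ l → ¬ (i ≡ k × j ≡ l) →
                toℕ j ℕ.∸ toℕ i ℕ.< toℕ l ℕ.∸ toℕ k
nested-width< {k = k} {l} {i} {j} k≤i i<j j≤l ≢ with ℕP.m≤n⇒m<n∨m≡n k≤i | ℕP.m≤n⇒m<n∨m≡n j≤l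
... | inj₁ k<i | _ = ℕP.≤-<-trans (ℕP.∸-monoˡ-≤ (toℕ i) j≤l) (ℕP.∸-monoʳ-< k<i (ℕP.<⇒≤ (ℕP.<-≤-trans i<j j≤l)))
... | inj₂ k≡i | inj₁ j<l = subst (λ t → toℕ j ℕ.∸ t ℕ.< toℕ l ℕ.∸ toℕ k) k≡i (ℕP.∸-monoˡ-< j<l (ℕP.≤-trans k≤i (ℕP.<⇒≤ i<j)))
... | inj₂ k≡i | inj₂ j≡l = contradiction (FinP.toℕ-injective (sym k≡i) , FinP.toℕ-injective j≡l) ≢

module _ {n} {A : Fin n → Fin n → Set} (A? : ∀ i j → Dec (A i j)) (A⇒< : ∀ {i j} → A i j → i Fin.< j) where

  minimal-inside : ∀ {k l} → A k l → ∃₂ λ i j → Minimal A i j × k Fin.≤ i × j Fin.≤ l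
  minimal-inside {k} {l} = go (<-wellFounded (toℕ l ℕ.∸ toℕ k))
    where
    StrictlyInside : Fin n → Fin n → Set
    StrictlyInside k l = ∃₂ λ i j → A i j × k Fin.≤ i × j Fin.≤ l × ¬ (i ≡ k × j ≡ l)
    strictlyInside? : ∀ k l → Dec (StrictlyInside k l)
    strictlyInside? k l = FinP.any? λ i → FinP.any? λ j →
      A? i j ×-dec k FinP.≤? i ×-dec j FinP.≤? l ×-dec ¬? (i FinP.≟ k ×-dec j FinP.≟ l)
    go : ∀ {k l} → Acc ℕ._<_ (toℕ l ℕ.∸ toℕ k) → A k l → ∃₂ λ i j → Minimal A i j × k Fin.≤ i × j Fin.≤ l
    go {k} {l} (acc smaller) a with strictlyInside? k l
    ... | no none = k , l , (a , same) , ℕP.≤-refl , ℕP.≤-refl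
      where
      same : ∀ {i j} → A i j → k Fin.≤ i → j Fin.≤ l → i ≡ k × j ≡ l
      same {i} {j} a′ k≤i j≤l with i FinP.≟ k ×-dec j FinP.≟ l
      ... | yes ≡ = ≡
      ... | no ≢ = contradiction (i , j , a′ , k≤i , j≤l , ≢) none
    ... | yes (i , j , a′ , k≤i , j≤l , ≢) with go (smaller (nested-width< k≤i (A⇒< a′) j≤l ≢)) a′
    ...   | i₀ , j₀ , min , i≤i₀ , j₀≤j = i₀ , j₀ , min , ℕP.≤-trans k≤i i≤i₀ , ℕP.≤-trans j₀≤j j≤l

  minimal-restrict : ∀ {A′ : Fin n → Fin n → Set} → (∀ {i j} → A′ i j → A i j) → (∀ {i j} → Minimal A i j → A′ i j) →
                     ∀ {i j} → Minimal A′ i j ⇔ Minimal A i j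
  minimal-restrict {A′} A′⊆A min⊆A′ = mk⇔ ⇒ (λ (a , min) → min⊆A′ (a , min) , λ a′ → min (A′⊆A a′))
    where
    ⇒ : ∀ {i j} → Minimal A′ i j → Minimal A i j
    ⇒ {i} {j} (a′ , min′) = A′⊆A a′ , squeeze
      where
      squeeze : ∀ {i′ j′} → A i′ j′ → i Fin.≤ i′ → j′ Fin.≤ j → i′ ≡ i × j′ ≡ j
      squeeze a i≤i′ j′≤j with minimal-inside a
      ... | i₀ , j₀ , min₀ , i′≤i₀ , j₀≤j′ with min′ (min⊆A′ min₀) (ℕP.≤-trans i≤i′ i′≤i₀) (ℕP.≤-trans j₀≤j′ j′≤j)
      ...   | refl , refl = FinP.≤-antisym i′≤i₀ i≤i′ , FinP.≤-antisym j′≤j j₀≤j′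

  minimal-generates : ∀ {A′ C : Fin n → Fin n → Set} → (∀ {i j} → Minimal A i j → A′ i j) →
                      (∀ {i j i′ j′} → A′ i′ j′ → i Fin.≤ i′ → j′ Fin.≤ j → C i j → A′ i j) →
                      ∀ {i j} → C i j → A i j → A′ i j
  minimal-generates min⊆A′ A′-closed c a with minimal-inside a
  ... | _ , _ , min , i≤i₀ , j₀≤j = A′-closed (min⊆A′ min) i≤i₀ j₀≤j c

Above-determined : ∀ {n} {σ : Permutation′ n} {x y} → SortedBy σ y →
                   (∀ {i j} → Minimal (Above σ x) i j → Minimal (Above σ y) i j) → ∀ {i j} → Above σ x i j → Above σ y i j
Above-determined {σ = σ} {x} {y} y-sorted min⊆ ab@(_ , σi<σj , _) =
  minimal-generates (above? σ x) proj₁ {C = λ i j → σ ⟨$⟩ʳ i Fin.< σ ⟨$⟩ʳ j} (proj₁ ∘ min⊆)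
    (Above-nested {σ = σ} {y} y-sorted) σi<σj ab

Corner : (ℕ → ℕ) → ℕ → ℕ → Set
Corner g i j = g j ≡ suc i × (∀ {j′} → j′ ℕ.< j → g j′ ℕ.≤ i)

corner-cong : ∀ {f g : ℕ → ℕ} {i j} → (∀ {l} → l ℕ.≤ j → f l ≡ g l) → Corner f i j → Corner g i j
corner-cong f≗g (fj≡ , before) = trans (sym (f≗g ℕP.≤-refl)) fj≡ , λ l<j → subst (ℕ._≤ _) (f≗g (ℕP.<⇒≤ l<j)) (before l<j)

record HeightOf {n} (A : Fin n → Fin n → Set) (g : ℕ → ℕ) : Set where
  field
    height-above   : ∀ {i j l} → A i j → toℕ j ℕ.≤ l → toℕ i ℕ.< g l
    height-witness : ∀ {k l} → l ℕ.< n → k ℕ.< g l → ∃₂ λ i j → A i j × toℕ j ℕ.≤ l × k ℕ.≤ toℕ i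

module _ {n} {A : Fin n → Fin n → Set} {g : ℕ → ℕ} (height : HeightOf A g) where
  open HeightOf height

  corner-inside : ∀ {i j : Fin n} → Corner g (toℕ i) (toℕ j) →
                  ∀ {i′ j′} → A i′ j′ → i Fin.≤ i′ → j′ Fin.≤ j → i′ ≡ i × j′ ≡ j
  corner-inside {i} {j} (gj≡1+i , before) {i′} {j′} a′ i≤i′ j′≤j =
    FinP.≤-antisym (ℕP.≤-pred (subst (toℕ i′ ℕ.<_) gj≡1+i (height-above a′ j′≤j))) i≤i′ , j′≡j
    where
    j′≡j : j′ ≡ j
    j′≡j with ℕP.m≤n⇒m<n∨m≡n j′≤j
    ... | inj₁ j′<j = contradiction (ℕP.<-≤-trans (height-above a′ ℕP.≤-refl) (before j′<j)) (ℕP.≤⇒≯ i≤i′)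
    ... | inj₂ j′≡j = FinP.toℕ-injective j′≡j

  corner⇔minimal : ∀ {i j : Fin n} → Corner g (toℕ i) (toℕ j) ⇔ Minimal A i j
  corner⇔minimal {i} {j} = mk⇔ ⇒ ⇐
    where
    ⇒ : Corner g (toℕ i) (toℕ j) → Minimal A i j
    ⇒ corner@(gj≡1+i , _) with height-witness (FinP.toℕ<n j) (subst (toℕ i ℕ.<_) (sym gj≡1+i) ℕP.≤-refl)
    ... | i₀ , j₀ , a₀ , j₀≤j , i≤i₀ with corner-inside corner a₀ i≤i₀ j₀≤j
    ...   | refl , refl = a₀ , corner-inside corner
    ⇐ : Minimal A i j → Corner g (toℕ i) (toℕ j)
    ⇐ (a , min) = ℕP.≤-antisym (ℕP.≮⇒≥ too-high) (height-above a ℕP.≤-refl) , λ j′<j → ℕP.≮⇒≥ (early j′<j)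
      where
      too-high : ¬ (suc (toℕ i) ℕ.< g (toℕ j))
      too-high 1+i<g with height-witness (FinP.toℕ<n j) 1+i<g
      ... | i₀ , j₀ , a₀ , j₀≤j , 1+i≤i₀ with min a₀ (ℕP.<⇒≤ 1+i≤i₀) j₀≤j
      ...   | refl , _ = ℕP.<-irrefl refl 1+i≤i₀
      early : ∀ {j′} → j′ ℕ.< toℕ j → ¬ (toℕ i ℕ.< g j′)
      early j′<j i<g with height-witness (ℕP.<-trans j′<j (FinP.toℕ<n j)) i<g
      ... | i₀ , j₀ , a₀ , j₀≤j′ , i≤i₀ with min a₀ i≤i₀ (ℕP.≤-trans j₀≤j′ (ℕP.<⇒≤ j′<j))
      ...   | _ , refl = ℕP.<-irrefl refl (ℕP.≤-<-trans j₀≤j′ j′<j)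

  height-mono : ∀ {l l′} → l ℕ.≤ l′ → l ℕ.< n → g l ℕ.≤ g l′
  height-mono l≤l′ l<n = ℕP.≮⇒≥ λ g′<g →
    let (i , j , a , j≤l , g′≤i) = height-witness l<n g′<g
    in ℕP.<-irrefl refl (ℕP.≤-<-trans g′≤i (height-above a (ℕP.≤-trans j≤l l≤l′)))

  height-bounded : (∀ {i j} → A i j → i Fin.< j) → ∀ {l} → l ℕ.< n → g l ℕ.≤ l
  height-bounded A⇒< l<n = ℕP.≮⇒≥ λ l<g →
    let (i , j , a , j≤l , l≤i) = height-witness l<n l<g
    in ℕP.<-irrefl refl (ℕP.≤-<-trans l≤i (ℕP.<-≤-trans (A⇒< a) j≤l))

⨆ : ∀ {n} → (Fin n → ℕ) → ℕ
⨆ {zero} f = 0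
⨆ {suc n} f = f Fin.zero ℕ.⊔ ⨆ (f ∘ Fin.suc)

≤-⨆ : ∀ {n} (f : Fin n → ℕ) i → f i ℕ.≤ ⨆ f
≤-⨆ f Fin.zero = ℕP.m≤m⊔n _ _
≤-⨆ f (Fin.suc i) = ℕP.≤-trans (≤-⨆ (f ∘ Fin.suc) i) (ℕP.m≤n⊔m _ _)

<-⨆⇒ : ∀ {n} (f : Fin n → ℕ) {k} → k ℕ.< ⨆ f → ∃[ i ] k ℕ.< f i
<-⨆⇒ {suc n} f {k} k<⨆ with ℕP.⊔-sel (f Fin.zero) (⨆ (f ∘ Fin.suc))
... | inj₁ ⨆≡f₀ = Fin.zero , subst (k ℕ.<_) ⨆≡f₀ k<⨆
... | inj₂ ⨆≡⨆ₛ = let (i , k<fi) = <-⨆⇒ (f ∘ Fin.suc) (subst (k ℕ.<_) ⨆≡⨆ₛ k<⨆) in Fin.suc i , k<fi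

weight : ∀ {P : Set} → Dec P → ℕ → ℕ
weight (yes _) m = m
weight (no _)  _ = 0

weight-yes : ∀ {P : Set} (p? : Dec P) {m} → P → weight p? m ≡ m
weight-yes (yes _) _ = refl
weight-yes (no ¬p) p = contradiction p ¬p

weight-witness : ∀ {P : Set} (p? : Dec P) {k m} → k ℕ.< weight p? m → P × k ℕ.< m
weight-witness (yes p) k<m = p , k<m

module _ {n} {A : Fin n → Fin n → Set} (A? : ∀ i j → Dec (A i j)) where

  heightOf : ℕ → ℕ
  heightOf l = ⨆ λ i → ⨆ λ j → weight (A? i j ×-dec toℕ j ℕ.≤? l) (suc (toℕ i))

  heightOf-height : HeightOf A heightOf
  heightOf-height = record { height-above = inside-height ; height-witness = witness }
    where
    inside-height : ∀ {i j l} → A i j → toℕ j ℕ.≤ l → toℕ i ℕ.< heightOf l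
    inside-height {i} {j} {l} a j≤l = ℕP.≤-trans (ℕP.≤-reflexive (sym (weight-yes (A? i j ×-dec toℕ j ℕ.≤? l) (a , j≤l))))
                                          (ℕP.≤-trans (≤-⨆ _ j) (≤-⨆ _ i))
    witness : ∀ {k l} → l ℕ.< n → k ℕ.< heightOf l → ∃₂ λ i j → A i j × toℕ j ℕ.≤ l × k ℕ.≤ toℕ i
    witness {k} {l} _ k<h =
      let (i , k<⨆) = <-⨆⇒ _ k<h
          (j , k<w) = <-⨆⇒ _ k<⨆
          ((a , j≤l) , k<1+i) = weight-witness (A? i j ×-dec toℕ j ℕ.≤? l) k<w
      in i , j , a , j≤l , ℕP.≤-pred k<1+i

-- Floors

-- Pushing z off the wall H¹_AB into R moves it only by δ, and CellExcept survives since it is open.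
facet-from-wall : ∀ {n} (R : Region n) {A B w} → A Fin.< B → signs R A B ≡ above → InV w → pair w A B ≡ 1ℚ →
                  CellExcept (signs R) A B w → SupportsFacet R A B 1ℚ
facet-from-wall R {A} {B} {w} A<B AB-above w∈V w-on-H w-except = w , ½ * r , ½*-pos 0<r , w∈V , w-on-H , closure
  where
  open-nbhd = CellExcept-open (signs R) A B w-except
  r = proj₁ open-nbhd
  0<r = proj₁ (proj₂ open-nbhd)
  except-near = proj₂ (proj₂ open-nbhd)
  A≢B : A ≢ B
  A≢B A≡B = ℕP.<⇒≢ A<B (cong toℕ A≡B)
  closure : ∀ z → InV z → pair z A B ≡ 1ℚ → Near (½ * r) z w → InClosure R z
  closure z z∈V z-on-H z~w ε 0<ε = y , y∈R , near-weaken {x = z} {y} (ℚP.p⊓q≤p ε (½ * r)) (near-sym {x = y} {z} y~z)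
    where
    small = ∃-small (0<⊓ 0<ε (½*-pos 0<r))
    δ = proj₁ small
    y = transfer A B δ z
    y~z : Near (ε ⊓ (½ * r)) y z
    y~z = transfer-near A B δ z (proj₂ (proj₂ small))
    y~w : Near r y w
    y~w = near-weaken {x = y} {w} (ℚP.≤-trans (ℚP.+-monoˡ-≤ (½ * r) (ℚP.p⊓q≤q ε (½ * r))) (ℚP.≤-reflexive (halves r)))
                                   (near-trans {x = y} {z} {w} y~z z~w)
    1<y : 1ℚ < pair y A B
    1<y = <-by-gap (+-pos (proj₁ (proj₂ small)) (proj₁ (proj₂ small)))
      (sym (trans (cong (_- 1ℚ) (trans (pair-transfer δ z A≢B) (cong (_+ (δ + δ)) z-on-H))) (gap δ)))
      where
      gap : ∀ δ → (1ℚ + (δ + δ)) - 1ℚ ≡ δ + δ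
      gap = solve-∀ ℚ-ring
    y∈R : y ∈R R
    y∈R = cell-from-except R (transfer-InV A B δ z∈V) (except-near y y~w) (subst (λ t → inStratum t (pair y A B)) (sym AB-above) 1<y)

wall-point : ∀ {n} (R : Region n) {A B x₁} → A Fin.< B → signs R A B ≡ above → InV x₁ →
             CellExcept (signs R) A B x₁ → pair x₁ A B < 1ℚ →
             ∃[ w ] (InV w × pair w A B ≡ 1ℚ × CellExcept (signs R) A B w)
wall-point R {A} {B} {x₁} A<B AB-above x₁∈V x₁-except x₁<1 =
  conv t x₀ x₁ , conv-InV t {x₀} {x₁} (proj₁ (sample∈R R)) x₁∈V , trans (pair-conv t x₀ x₁ A B) on-1 , except
  where
  x₀ = sample R
  1<x₀ : 1ℚ < pair x₀ A B
  1<x₀ = subst (λ s → inStratum s (pair x₀ A B)) AB-above (proj₂ (sample∈R R) A B A<B)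
  crossed = crossing x₁<1 1<x₀
  t = proj₁ crossed
  0<t = proj₁ (proj₂ crossed)
  t<1 = proj₁ (proj₂ (proj₂ crossed))
  on-1 = proj₂ (proj₂ (proj₂ crossed))
  except : CellExcept (signs R) A B (conv t x₀ x₁)
  except a b a<b ab≢AB = subst (inStratum (signs R a b)) (sym (pair-conv t x₀ x₁ a b))
    (stratum-convex (signs R a b) 0<t t<1 (proj₂ (sample∈R R) a b a<b) (x₁-except a b a<b ab≢AB))

wiggle-in-closure : ∀ {n} (R : Region n) {A B c : Fin n} {x ε} → A ≢ B → c ≢ A → c ≢ B → InV x → pair x A B ≡ 1ℚ →
                    (∀ z → InV z → pair z A B ≡ 1ℚ → Near ε z x → InClosure R z) →
                    ∀ v → ∣ v ∣ + ∣ v ∣ < ½ * ε → InClosure R (wiggle c A B v x)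
wiggle-in-closure R {A} {B} {c} {x} {ε} A≢B c≢A c≢B x∈V x-on-H facet v small =
  facet (wiggle c A B v x) (transfer-InV c A v {transfer c B v x} (transfer-InV c B v {x} x∈V))
    (trans (pair-wiggle-AB c≢A c≢B A≢B v x) x-on-H)
    (subst (λ r → Near r (wiggle c A B v x) x) (halves ε)
      (near-trans {x = wiggle c A B v x} {transfer c B v x} {x}
        (transfer-near c A v (transfer c B v x) small) (transfer-near c B v x small)))

module Floors {m} {σ : Permutation′ (suc m)} (R : Region (suc m)) (R⊆σC : InChamber σ R) where

  private
    x₀ = sample R

  σ-≢ : ∀ {k l} → toℕ k ≢ toℕ l → σ ⟨$⟩ʳ k ≢ σ ⟨$⟩ʳ l
  σ-≢ k≢l σk≡σl = k≢l (cong toℕ (⟨$⟩ʳ-injective σ σk≡σl))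

  closure-sorted : ∀ {z} → InClosure R z → ∀ {i i′} → i Fin.≤ i′ → 0ℚ ≤ pair z (σ ⟨$⟩ʳ i) (σ ⟨$⟩ʳ i′)
  closure-sorted {z} z̄ {i} {i′} i≤i′ with ℕP.m≤n⇒m<n∨m≡n i≤i′
  ... | inj₁ i<i′ = closure-≥ R {0ℚ} {σ ⟨$⟩ʳ i} {σ ⟨$⟩ʳ i′}
          (λ y y∈R → p<q⇒0<q-p {y (σ ⟨$⟩ʳ i′)} {y (σ ⟨$⟩ʳ i)} (chamber-sorts {σ = σ} R R⊆σC {y} y∈R i<i′)) z z̄
  ... | inj₂ i≡i′ = ℚP.≤-reflexive (sym (p≡q⇒p-q≡0 (cong (λ k → z (σ ⟨$⟩ʳ k)) (FinP.toℕ-injective i≡i′))))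

  closure-above : ∀ {z} → InClosure R z → ∀ {i j} → Above σ x₀ i j → 1ℚ ≤ pair z (σ ⟨$⟩ʳ i) (σ ⟨$⟩ʳ j)
  closure-above {z} z̄ {i} {j} ab = closure-≥ R {1ℚ} {σ ⟨$⟩ʳ i} {σ ⟨$⟩ʳ j}
    (λ y y∈R → proj₂ (proj₂ (Above-region {σ = σ} R {x₀} {y} {i} {j} (sample∈R R) y∈R ab))) z z̄

  -- At the facet point x the nested pair forces x_A = x_{a′} and x_{b′} = x_B; wiggling x inside the facet breaks one of them.
  module AtFacet {i j} (σi<σj : σ ⟨$⟩ʳ i Fin.< σ ⟨$⟩ʳ j) {x ε} (0<ε : 0ℚ < ε) (x∈V : InV x)
                 (x-on-H : pair x (σ ⟨$⟩ʳ i) (σ ⟨$⟩ʳ j) ≡ 1ℚ)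
                 (facet : ∀ z → InV z → pair z (σ ⟨$⟩ʳ i) (σ ⟨$⟩ʳ j) ≡ 1ℚ → Near ε z x → InClosure R z) where

    private
      A = σ ⟨$⟩ʳ i
      B = σ ⟨$⟩ʳ j
      A≢B : A ≢ B
      A≢B A≡B = ℕP.<⇒≢ σi<σj (cong toℕ A≡B)
      x̄ : InClosure R x
      x̄ = facet x x∈V x-on-H (λ k → subst (_< ε) (sym (cong ∣_∣ (ℚP.+-inverseʳ (x k)))) 0<ε)
      small = ∃-small (½*-pos 0<ε)
      δ = proj₁ small
      0<3δ : 0ℚ < δ + δ + δ
      0<3δ = +-pos (+-pos (proj₁ (proj₂ small)) (proj₁ (proj₂ small))) (proj₁ (proj₂ small))

    squeezed : ∀ {i′ j′} → Above σ x₀ i′ j′ → i Fin.≤ i′ → j′ Fin.≤ j →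
               pair x A (σ ⟨$⟩ʳ i′) ≤ 0ℚ × pair x (σ ⟨$⟩ʳ j′) B ≤ 0ℚ
    squeezed {i′} {j′} ab′ i≤i′ j′≤j =
      squeeze-sum (closure-sorted {x} x̄ i≤i′) (closure-above {x} x̄ ab′) (closure-sorted {x} x̄ j′≤j)
        (trans (telescope (x A) (x (σ ⟨$⟩ʳ i′)) (x (σ ⟨$⟩ʳ j′)) (x B)) x-on-H)
      where
      telescope : ∀ p q r s → (p - q) + (q - r) + (r - s) ≡ p - s
      telescope = solve-∀ ℚ-ring

    left-tight : ∀ {i′ j′} → Above σ x₀ i′ j′ → i Fin.≤ i′ → j′ Fin.≤ j → i′ ≡ i
    left-tight {i′} {j′} ab′@(i′<j′ , _ , _) i≤i′ j′≤j with i′ FinP.≟ i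
    ... | yes i′≡i = i′≡i
    ... | no i′≢i = contradiction
      (subst (0ℚ ≤_) (pair-wiggle-Ac a′≢A a′≢B A≢B δ x)
         (closure-sorted {wiggle a′ A B δ x} (wiggle-in-closure R A≢B a′≢A a′≢B x∈V x-on-H facet δ (proj₂ (proj₂ small))) i≤i′))
      (<⇒≱ (nonpos-minus-pos (proj₁ (squeezed ab′ i≤i′ j′≤j)) 0<3δ))
      where
      a′ = σ ⟨$⟩ʳ i′
      a′≢A = σ-≢ (i′≢i ∘ FinP.toℕ-injective)
      a′≢B = σ-≢ (ℕP.<⇒≢ (ℕP.<-≤-trans i′<j′ j′≤j))

    right-tight : ∀ {i′ j′} → Above σ x₀ i′ j′ → i Fin.≤ i′ → j′ Fin.≤ j → j′ ≡ j
    right-tight {i′} {j′} ab′@(i′<j′ , _ , _) i≤i′ j′≤j with j′ FinP.≟ j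
    ... | yes j′≡j = j′≡j
    ... | no j′≢j = contradiction
      (subst (0ℚ ≤_) (trans (pair-wiggle-cB b′≢A b′≢B A≢B (- δ) x) (cong (pair x b′ B +_) (negate δ)))
         (closure-sorted {wiggle b′ A B (- δ) x}
            (wiggle-in-closure R A≢B b′≢A b′≢B x∈V x-on-H facet (- δ)
               (subst (λ u → u + u < ½ * ε) (sym (ℚP.∣-p∣≡∣p∣ δ)) (proj₂ (proj₂ small)))) j′≤j))
      (<⇒≱ (nonpos-minus-pos (proj₂ (squeezed ab′ i≤i′ j′≤j)) 0<3δ))
      where
      b′ = σ ⟨$⟩ʳ j′
      b′≢A = σ-≢ (ℕP.<⇒≢ (ℕP.≤-<-trans i≤i′ i′<j′) ∘ sym)
      b′≢B = σ-≢ (j′≢j ∘ FinP.toℕ-injective)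
      negate : ∀ d → - d + - d + - d ≡ - (d + d + d)
      negate = solve-∀ ℚ-ring

  floor⇒minimal : ∀ {i j} → σ ⟨$⟩ʳ i Fin.< σ ⟨$⟩ʳ j → InFL R (σ ⟨$⟩ʳ i) (σ ⟨$⟩ʳ j) → Minimal (Above σ x₀) i j
  floor⇒minimal {i} {j} σi<σj ((x , ε , 0<ε , x∈V , x-on-H , facet) , _ , separates) =
    (sorted-index< {σ = σ} {x₀} R⊆σC (0<q-p⇒p<q (ℚP.<-trans 0<1 1<x₀)) , σi<σj , 1<x₀) ,
    λ ab′ i≤i′ j′≤j → left-tight ab′ i≤i′ j′≤j , right-tight ab′ i≤i′ j′≤j
    where
    open AtFacet σi<σj 0<ε x∈V x-on-H facet
    1<x₀ : 1ℚ < pair x₀ (σ ⟨$⟩ʳ i) (σ ⟨$⟩ʳ j)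
    1<x₀ = [ (λ (_ , R-beyond) → R-beyond x₀ (sample∈R R)) , (λ (1<0 , _) → contradiction 1<0 (ℚP.<-asym 0<1)) ]′ separates

  -- A point of the region obtained from R by lowering the single minimal pair (i, j) below H¹.
  module Lowered {i j} (ij-minimal : Minimal (Above σ x₀) i j) where

    private
      A = σ ⟨$⟩ʳ i
      B = σ ⟨$⟩ʳ j
      i<j = proj₁ (proj₁ ij-minimal)
      σi<σj = proj₁ (proj₂ (proj₁ ij-minimal))

    OtherAboveInside : Fin (suc m) → Fin (suc m) → Set
    OtherAboveInside k l = ∃₂ λ k′ l′ → Above σ x₀ k′ l′ × (k′ , l′) ≢ (i , j) × k Fin.≤ k′ × l′ Fin.≤ l

    otherAboveInside? : ∀ k l → Dec (OtherAboveInside k l)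
    otherAboveInside? k l = FinP.any? λ k′ → FinP.any? λ l′ →
      above? σ x₀ k′ l′ ×-dec ¬? ((k′ , l′) ≟² (i , j)) ×-dec k FinP.≤? k′ ×-dec l′ FinP.≤? l

    otherAboveInside-closed : NestingClosed OtherAboveInside
    otherAboveInside-closed (k′ , l′ , ab , ≢ , k≤k′ , l′≤l) k″≤k l≤l″ = k′ , l′ , ab , ≢ , ℕP.≤-trans k″≤k k≤k′ , ℕP.≤-trans l′≤l l≤l″

    module Neighbour = Realised σ otherAboveInside? otherAboveInside-closed
    open Neighbour using (point)

    point-except : CellExcept (signs R) A B point
    point-except a b a<b ab≢AB =
      chamber-stratum {σ = σ} R R⊆σC {point} Neighbour.point-sorted a<b (stratum-≢0 t x∈t) (stratum-≢1 t x∈t) same-above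
      where
      t = proj₁ (Neighbour.point-stratified a<b)
      x∈t = proj₂ (Neighbour.point-stratified a<b)
      k = σ ⟨$⟩ˡ a
      l = σ ⟨$⟩ˡ b
      kl≢ij : (k , l) ≢ (i , j)
      kl≢ij kl≡ij = ab≢AB (trans (sym (cong₂ _,_ (inverseʳ σ) (inverseʳ σ))) (cong (λ p → σ ⟨$⟩ʳ proj₁ p , σ ⟨$⟩ʳ proj₂ p) kl≡ij))
      same-above : Above σ x₀ k l ⇔ Above σ point k l
      same-above = mk⇔
        (λ ab@(k<l , σk<σl , _) → from (Neighbour.Above⇔B k<l σk<σl) (k , l , ab , kl≢ij , ℕP.≤-refl , ℕP.≤-refl))
        (λ ab₁@(k<l , σk<σl , _) → let (k′ , l′ , ab′ , _ , k≤k′ , l′≤l) = to (Neighbour.Above⇔B k<l σk<σl) ab₁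
                                    in Above-nested {σ = σ} {x₀} R⊆σC ab′ k≤k′ l′≤l σk<σl)

    point-below-wall : pair point A B < 1ℚ
    point-below-wall =
      ≤∧≢⇒< (ℚP.≮⇒≥ not-above) (stratum-≢1 (proj₁ (Neighbour.point-stratified σi<σj)) (proj₂ (Neighbour.point-stratified σi<σj)))
      where
      not-above : ¬ (1ℚ < pair point A B)
      not-above 1<x₁ =
        let (k′ , l′ , ab′ , k′l′≢ij , i≤k′ , l′≤j) = to (Neighbour.Above⇔B i<j σi<σj) (i<j , σi<σj , 1<x₁)
        in k′l′≢ij (cong₂ _,_ (proj₁ (proj₂ ij-minimal ab′ i≤k′ l′≤j)) (proj₂ (proj₂ ij-minimal ab′ i≤k′ l′≤j)))

  minimal⇒floor : ∀ {i j} → Minimal (Above σ x₀) i j → InFL R (σ ⟨$⟩ʳ i) (σ ⟨$⟩ʳ j)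
  minimal⇒floor {i} {j} ij-minimal@(ij-above@(_ , σi<σj , 1<x₀) , _) =
      facet-from-wall R {w = proj₁ wall} σi<σj AB-above
        (proj₁ (proj₂ wall)) (proj₁ (proj₂ (proj₂ wall))) (proj₂ (proj₂ (proj₂ wall)))
    , ℚP.1≢0 ∘ sym
    , inj₁ (0<1 , λ y y∈R → proj₂ (proj₂ (Above-region {σ = σ} R {x₀} {y} {i} {j} (sample∈R R) y∈R ij-above)))
    where
    open Lowered ij-minimal
    AB-above : signs R (σ ⟨$⟩ʳ i) (σ ⟨$⟩ʳ j) ≡ above
    AB-above = stratum-unique {signs R _ _} {above} (proj₂ (sample∈R R) _ _ σi<σj) 1<x₀
    wall = wall-point R {x₁ = Neighbour.point} σi<σj AB-above Neighbour.point-InV point-except point-below-wall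

  floor⇔minimal : ∀ {i j} → σ ⟨$⟩ʳ i Fin.< σ ⟨$⟩ʳ j → InFL R (σ ⟨$⟩ʳ i) (σ ⟨$⟩ʳ j) ⇔ Minimal (Above σ x₀) i j
  floor⇔minimal σi<σj = mk⇔ (floor⇒minimal σi<σj) minimal⇒floor

-- Dyck paths

rise : List Step → ℕ → ℕ
rise []      _       = 0
rise (E ∷ p) j       = suc (rise p j)
rise (N ∷ p) zero    = 0
rise (N ∷ p) (suc j) = rise p j

ValleyAt : List Step → ℕ → ℕ → Set
ValleyAt p i j = Σ[ q ∈ List Step ] Σ[ r ∈ List Step ] (p ≡ q ++ (E ∷ N ∷ r) × countE q ≡ i × countN q ≡ j)

rise-mono : ∀ p {j j′} → j ℕ.≤ j′ → rise p j ℕ.≤ rise p j′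
rise-mono []      _ = z≤n
rise-mono (E ∷ p) j≤j′ = s≤s (rise-mono p j≤j′)
rise-mono (N ∷ p) {zero} _ = z≤n
rise-mono (N ∷ p) {suc j} {suc j′} (s≤s j≤j′) = rise-mono p j≤j′

corner-of-valley : ∀ q r → Corner (rise (q ++ E ∷ N ∷ r)) (countE q) (countN q) × countN q ℕ.< countN (q ++ E ∷ N ∷ r)
corner-of-valley [] r = (refl , λ ()) , s≤s z≤n
corner-of-valley (E ∷ q) r =
  let ((rise≡ , before) , inside) = corner-of-valley q r
  in (cong suc rise≡ , λ j′<j → s≤s (before j′<j)) , inside
corner-of-valley (N ∷ q) r =
  let ((rise≡ , before) , inside) = corner-of-valley q r
  in (rise≡ , λ { {zero} _ → z≤n ; {suc j′} (s≤s j′<j) → before j′<j }) , s≤s inside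

valley-of-corner : ∀ p {i j} → Corner (rise p) i j → j ℕ.< countN p → ValleyAt p i j
valley-of-corner (E ∷ p) {zero} {zero} (rise≡1 , _) 0<N =
  let (r , p≡) = tail p (ℕP.suc-injective rise≡1) 0<N in [] , r , cong (E ∷_) p≡ , refl , refl
  where
  tail : ∀ p → rise p 0 ≡ 0 → 0 ℕ.< countN p → ∃[ r ] p ≡ N ∷ r
  tail (N ∷ r) _ _ = r , refl
  tail (E ∷ _) ()
valley-of-corner (E ∷ p) {zero} {suc j} (_ , before) _ = contradiction (before (s≤s z≤n)) λ ()
valley-of-corner (E ∷ p) {suc i} (rise≡ , before) j<N =
  let (q , r , p≡ , E≡ , N≡) = valley-of-corner p (ℕP.suc-injective rise≡ , ℕP.≤-pred ∘ before) j<N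
  in E ∷ q , r , cong (E ∷_) p≡ , cong suc E≡ , N≡
valley-of-corner (N ∷ p) {i} {suc j} (rise≡ , before) (s≤s j<N) =
  let (q , r , p≡ , E≡ , N≡) = valley-of-corner p (rise≡ , λ j′<j → before (s≤s j′<j)) j<N
  in N ∷ q , r , cong (N ∷_) p≡ , E≡ , cong suc N≡

valley⇔corner : ∀ {p i j} → ValleyAt p i j ⇔ (Corner (rise p) i j × j ℕ.< countN p)
valley⇔corner {p} = mk⇔ (λ { (q , r , refl , refl , refl) → corner-of-valley q r }) (λ (corner , j<N) → valley-of-corner p corner j<N)

split-at-N : ∀ p {j} → j ℕ.< countN p → ∃₂ λ q r → p ≡ q ++ N ∷ r × countN q ≡ j × countE q ≡ rise p j
split-at-N (E ∷ p) j<N = let (q , r , p≡ , N≡ , E≡) = split-at-N p j<N in E ∷ q , r , cong (E ∷_) p≡ , N≡ , cong suc E≡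
split-at-N (N ∷ p) {zero} _ = [] , p , refl , refl , refl
split-at-N (N ∷ p) {suc j} (s≤s j<N) = let (q , r , p≡ , N≡ , E≡) = split-at-N p j<N in N ∷ q , r , cong (N ∷_) p≡ , cong suc N≡ , E≡

rise≤ : ∀ {p} → NeverBelow p → ∀ {j} → j ℕ.< countN p → rise p j ℕ.≤ j
rise≤ {p} never-below j<N = let (q , r , p≡ , N≡ , E≡) = split-at-N p j<N in subst₂ ℕ._≤_ E≡ N≡ (never-below q (N ∷ r) p≡)

countN-++ : ∀ q r → countN q ℕ.≤ countN (q ++ r)
countN-++ []      r = z≤n
countN-++ (E ∷ q) r = countN-++ q r
countN-++ (N ∷ q) r = s≤s (countN-++ q r)

countE-++ : ∀ q r → countE q ℕ.≤ countE (q ++ r)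
countE-++ []      r = z≤n
countE-++ (E ∷ q) r = s≤s (countE-++ q r)
countE-++ (N ∷ q) r = countE-++ q r

countE≤rise : ∀ q r → countN q ℕ.< countN (q ++ r) → countE q ℕ.≤ rise (q ++ r) (countN q)
countE≤rise []      r _ = z≤n
countE≤rise (E ∷ q) r q<N = s≤s (countE≤rise q r q<N)
countE≤rise (N ∷ q) r (s≤s q<N) = countE≤rise q r q<N

-- Every prefix either stops before some N step, whose rise bounds it, or contains all N steps.
never-below : ∀ p → countE p ℕ.≤ countN p → (∀ {j} → j ℕ.< countN p → rise p j ℕ.≤ j) → NeverBelow p
never-below .(q ++ r) E≤N rise≤j q r refl with ℕP.m≤n⇒m<n∨m≡n (countN-++ q r)
... | inj₁ q<N = ℕP.≤-trans (countE≤rise q r q<N) (rise≤j q<N)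
... | inj₂ q≡N = ℕP.≤-trans (countE-++ q r) (subst (countE (q ++ r) ℕ.≤_) (sym q≡N) E≤N)

fromHeights : ℕ → (ℕ → ℕ) → ℕ → List Step
fromHeights zero    g e = replicate e E
fromHeights (suc k) g e with g 0
fromHeights (suc k) g e       | zero  = N ∷ fromHeights k (g ∘ suc) e
fromHeights (suc k) g zero    | suc _ = []   -- unreachable when g is bounded by the number of E steps
fromHeights (suc k) g (suc e) | suc _ = E ∷ fromHeights (suc k) (ℕ.pred ∘ g) e

record Heights (k : ℕ) (g : ℕ → ℕ) (e : ℕ) : Set where
  field
    bounded   : ∀ {l} → l ℕ.< k → g l ℕ.≤ e
    monotone  : ∀ {l l′} → l ℕ.≤ l′ → l′ ℕ.< k → g l ℕ.≤ g l′

no-room : ∀ {k g x} → Heights (suc k) g 0 → g 0 ≢ suc x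
no-room h g0≡1+x = contradiction (subst (ℕ._≤ 0) g0≡1+x (Heights.bounded h (s≤s z≤n))) λ ()

heights-N : ∀ {k g e} → Heights (suc k) g e → Heights k (g ∘ suc) e
heights-N h = record
  { bounded  = λ l<k → Heights.bounded h (s≤s l<k)
  ; monotone = λ l≤l′ l′<k → Heights.monotone h (s≤s l≤l′) (s≤s l′<k)
  }

heights-E : ∀ {k g e} → Heights k g (suc e) → Heights k (ℕ.pred ∘ g) e
heights-E h = record
  { bounded  = λ l<k → ℕP.pred-mono-≤ (Heights.bounded h l<k)
  ; monotone = λ l≤l′ l′<k → ℕP.pred-mono-≤ (Heights.monotone h l≤l′ l′<k)
  }

countN-fromHeights : ∀ k g e → Heights k g e → countN (fromHeights k g e) ≡ k
countN-fromHeights zero g e _ = countN-replicate e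
  where
  countN-replicate : ∀ e → countN (replicate e E) ≡ 0
  countN-replicate zero = refl
  countN-replicate (suc e) = countN-replicate e
countN-fromHeights (suc k) g e h with g 0 in g0≡
countN-fromHeights (suc k) g e h       | zero  = cong suc (countN-fromHeights k (g ∘ suc) e (heights-N h))
countN-fromHeights (suc k) g zero h    | suc _ = contradiction g0≡ (no-room h)
countN-fromHeights (suc k) g (suc e) h | suc _ = countN-fromHeights (suc k) (ℕ.pred ∘ g) e (heights-E h)

countE-fromHeights : ∀ k g e → Heights k g e → countE (fromHeights k g e) ≡ e
countE-fromHeights zero g e _ = countE-replicate e
  where
  countE-replicate : ∀ e → countE (replicate e E) ≡ e
  countE-replicate zero = refl
  countE-replicate (suc e) = cong suc (countE-replicate e)
countE-fromHeights (suc k) g e h with g 0 in g0≡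
countE-fromHeights (suc k) g e h       | zero  = countE-fromHeights k (g ∘ suc) e (heights-N h)
countE-fromHeights (suc k) g zero h    | suc _ = contradiction g0≡ (no-room h)
countE-fromHeights (suc k) g (suc e) h | suc _ = cong suc (countE-fromHeights (suc k) (ℕ.pred ∘ g) e (heights-E h))

rise-fromHeights : ∀ k g e → Heights k g e → ∀ {l} → l ℕ.< k → rise (fromHeights k g e) l ≡ g l
rise-fromHeights (suc k) g e h {l} l<k with g 0 in g0≡
rise-fromHeights (suc k) g e h {zero} l<k | zero = sym g0≡
rise-fromHeights (suc k) g e h {suc l} (s≤s l<k) | zero = rise-fromHeights k (g ∘ suc) e (heights-N h) l<k
rise-fromHeights (suc k) g zero h l<k | suc _ = contradiction g0≡ (no-room h)
rise-fromHeights (suc k) g (suc e) h {l} l<k | suc _ =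
  trans (cong suc (rise-fromHeights (suc k) (ℕ.pred ∘ g) e (heights-E h) l<k)) (suc-pred (g l) g0≤gl)
  where
  g0≤gl : suc _ ℕ.≤ g l
  g0≤gl = subst (ℕ._≤ g l) g0≡ (Heights.monotone h z≤n l<k)
  suc-pred : ∀ x {y} → suc y ℕ.≤ x → suc (ℕ.pred x) ≡ x
  suc-pred (suc x) _ = refl

valley-E⁺ : ∀ {p i j} → ValleyAt p i j → ValleyAt (E ∷ p) (suc i) j
valley-E⁺ (q , r , p≡ , E≡ , N≡) = E ∷ q , r , cong (E ∷_) p≡ , cong suc E≡ , N≡

valley-N⁺ : ∀ {p i j} → ValleyAt p i j → ValleyAt (N ∷ p) i (suc j)
valley-N⁺ (q , r , p≡ , E≡ , N≡) = N ∷ q , r , cong (N ∷_) p≡ , E≡ , cong suc N≡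

valley-E⁻ : ∀ {p i j} → ValleyAt (E ∷ p) (suc i) j → ValleyAt p i j
valley-E⁻ (E ∷ q , r , refl , E≡ , N≡) = q , r , refl , ℕP.suc-injective E≡ , N≡

valley-N⁻ : ∀ {p i j} → ValleyAt (N ∷ p) i (suc j) → ValleyAt p i j
valley-N⁻ (N ∷ q , r , refl , E≡ , N≡) = q , r , refl , E≡ , ℕP.suc-injective N≡

no-valley-N0 : ∀ {p i} → ¬ ValleyAt (N ∷ p) i 0
no-valley-N0 (N ∷ q , r , refl , _ , ())

valley-E0 : ∀ p → 0 ℕ.< countN p → ∃[ i ] ValleyAt (E ∷ p) i 0
valley-E0 (N ∷ p) _ = 0 , [] , p , refl , refl , refl
valley-E0 (E ∷ p) 0<N = let (i , v) = valley-E0 p 0<N in suc i , valley-E⁺ v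

-- A path starting with E has a valley (i, 0); a path starting with N has none.
valleys-determine-path : ∀ p p′ → countN p ≡ countN p′ → countE p ≡ countE p′ →
                         (∀ {i j} → ValleyAt p i j → ValleyAt p′ i j) → (∀ {i j} → ValleyAt p′ i j → ValleyAt p i j) → p ≡ p′
valleys-determine-path [] [] _ _ _ _ = refl
valleys-determine-path [] (N ∷ _) () _ _ _
valleys-determine-path [] (E ∷ _) _ () _ _
valleys-determine-path (E ∷ p) (E ∷ p′) N≡ E≡ p⊆p′ p′⊆p = cong (E ∷_) (valleys-determine-path p p′ N≡ (ℕP.suc-injective E≡)
  (valley-E⁻ ∘ p⊆p′ ∘ valley-E⁺) (valley-E⁻ ∘ p′⊆p ∘ valley-E⁺))
valleys-determine-path (N ∷ p) (N ∷ p′) N≡ E≡ p⊆p′ p′⊆p = cong (N ∷_) (valleys-determine-path p p′ (ℕP.suc-injective N≡) E≡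
  (valley-N⁻ ∘ p⊆p′ ∘ valley-N⁺) (valley-N⁻ ∘ p′⊆p ∘ valley-N⁺))
valleys-determine-path (E ∷ p) (N ∷ p′) N≡ _ p⊆p′ _ =
  let (i , v) = valley-E0 p (subst (0 ℕ.<_) (sym N≡) (s≤s z≤n)) in contradiction (p⊆p′ v) no-valley-N0
valleys-determine-path (N ∷ p) (E ∷ p′) N≡ _ _ p′⊆p =
  let (i , v) = valley-E0 p′ (subst (0 ℕ.<_) N≡ (s≤s z≤n)) in contradiction (p′⊆p v) no-valley-N0

-- The bijection

module Correspondence {m : ℕ} where

  UnderPath : List Step → Fin (suc m) → Fin (suc m) → Set
  UnderPath p k l = toℕ k ℕ.< rise p (toℕ l)

  underPath? : ∀ p k l → Dec (UnderPath p k l)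
  underPath? p k l = toℕ k ℕ.<? rise p (toℕ l)

  underPath-closed : ∀ p → NestingClosed (UnderPath p)
  underPath-closed p k<rise k′≤k l≤l′ = ℕP.≤-trans (s≤s k′≤k) (ℕP.≤-trans k<rise (rise-mono p l≤l′))

  module _ {p} (dyck : IsDyck (suc m) p) where

    private
      rise<n : ∀ {l} → l ℕ.< suc m → rise p l ℕ.≤ l
      rise<n l<n = rise≤ (proj₂ (proj₂ dyck)) (subst (_ ℕ.<_) (sym (proj₁ dyck)) l<n)

    underPath⇒< : ∀ {k l} → UnderPath p k l → k Fin.< l
    underPath⇒< {k} {l} k<rise = ℕP.<-≤-trans k<rise (rise<n (FinP.toℕ<n l))

    underPath-height : HeightOf (UnderPath p) (rise p)
    underPath-height = record
      { height-above = λ k<rise j≤l → ℕP.<-≤-trans k<rise (rise-mono p j≤l)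
      ; height-witness = λ {k} {l} l<n k<rise →
          let k<n = ℕP.<-≤-trans k<rise (ℕP.≤-trans (rise<n l<n) (ℕP.<⇒≤ l<n))
          in fromℕ< k<n , fromℕ< l<n
           , subst₂ (λ a b → a ℕ.< rise p b) (sym (FinP.toℕ-fromℕ< k<n)) (sym (FinP.toℕ-fromℕ< l<n)) k<rise
           , ℕP.≤-reflexive (FinP.toℕ-fromℕ< l<n) , ℕP.≤-reflexive (sym (FinP.toℕ-fromℕ< k<n))
      }

    valley⇔minimal : ∀ {i j} → Valley p i j ⇔ Minimal (UnderPath p) i j
    valley⇔minimal {i} {j} = mk⇔
      (λ v → to (corner⇔minimal underPath-height) (proj₁ (to valley⇔corner v)))
      (λ min → from valley⇔corner
         (from (corner⇔minimal underPath-height) min , subst (_ ℕ.<_) (sym (proj₁ dyck)) (FinP.toℕ<n j)))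

    valley-fin : ∀ {a b} → ValleyAt p a b → ∃₂ λ (i j : Fin (suc m)) → toℕ i ≡ a × toℕ j ≡ b
    valley-fin {a} {b} v =
      let ((rise≡ , _) , b<N) = to valley⇔corner v
          b<n = subst (b ℕ.<_) (proj₁ dyck) b<N
          a<n = ℕP.<-≤-trans (subst (a ℕ.<_) (sym rise≡) ℕP.≤-refl) (ℕP.≤-trans (rise<n b<n) (ℕP.<⇒≤ b<n))
      in fromℕ< a<n , fromℕ< b<n , FinP.toℕ-fromℕ< a<n , FinP.toℕ-fromℕ< b<n

  ValleysAreMinimal : DLDyck (suc m) → Region (suc m) → Set
  ValleysAreMinimal (p , σ , _) R = ∀ {i j} → Valley p i j ⇔ Minimal (Above σ (sample R)) i j

  matches⇔ : ∀ (P : DLDyck (suc m)) R → Matches P R ⇔ (InChamber (proj₁ (proj₂ P)) R × ValleysAreMinimal P R)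
  matches⇔ P@(p , σ , _ , labelled) R = mk⇔ ⇒ ⇐
    where
    open Floors {σ = σ} R
    ⇒ : Matches P R → InChamber σ R × ValleysAreMinimal P R
    ⇒ (R⊆σC , floors) = R⊆σC′ , mk⇔ valley⇒minimal minimal⇒valley
      where
      R⊆σC′ : InChamber σ R
      R⊆σC′ = InWC⇒sorted {σ = σ} (R⊆σC (sample R) (sample∈R R))
      valley⇒minimal : ∀ {i j} → Valley p i j → Minimal (Above σ (sample R)) i j
      valley⇒minimal {i} {j} v = to (floor⇔minimal R⊆σC′ (labelled i j v))
        (proj₂ (floors _ _ (labelled i j v)) (i , j , v , refl , refl))
      minimal⇒valley : ∀ {i j} → Minimal (Above σ (sample R)) i j → Valley p i j
      minimal⇒valley {i} {j} min@((_ , σi<σj , _) , _) =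
        let (i′ , j′ , v , σi′≡σi , σj′≡σj) = proj₁ (floors _ _ σi<σj) (from (floor⇔minimal R⊆σC′ σi<σj) min)
        in subst₂ (Valley p) (⟨$⟩ʳ-injective σ σi′≡σi) (⟨$⟩ʳ-injective σ σj′≡σj) v
    ⇐ : InChamber σ R × ValleysAreMinimal P R → Matches P R
    ⇐ (R⊆σC , valleys) =
        (λ x x∈R → sorted⇒InWC {σ = σ} {x} (proj₁ x∈R) (chamber-sorts {σ = σ} R R⊆σC {x} x∈R))
      , λ a b a<b → floor⇒σA a<b , σA⇒floor
      where
      floor⇒σA : ∀ {a b} → a Fin.< b → InFL R a b → InσA P a b
      floor⇒σA {a} {b} a<b fl =
        let σi<σj = subst₂ Fin._<_ (sym (inverseʳ σ)) (sym (inverseʳ σ)) a<b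
            fl′ = subst₂ (InFL R) (sym (inverseʳ σ)) (sym (inverseʳ σ)) fl
        in σ ⟨$⟩ˡ a , σ ⟨$⟩ˡ b , from valleys (to (floor⇔minimal R⊆σC σi<σj) fl′) , inverseʳ σ , inverseʳ σ
      σA⇒floor : ∀ {a b} → InσA P a b → InFL R a b
      σA⇒floor (i , j , v , refl , refl) = from (floor⇔minimal R⊆σC (labelled i j v)) (to valleys v)

  module OfPath (P : DLDyck (suc m)) where

    private
      p = proj₁ P
      σ = proj₁ (proj₂ P)
      dyck = proj₁ (proj₂ (proj₂ P))
      labelled = proj₂ (proj₂ (proj₂ P))

    PositiveUnderPath : Fin (suc m) → Fin (suc m) → Set
    PositiveUnderPath k l = σ ⟨$⟩ʳ k Fin.< σ ⟨$⟩ʳ l × UnderPath p k l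

    module Point = Realised σ (underPath? p) (underPath-closed p)

    region : Region (suc m)
    region = Point.region

    Above⇔labelled : ∀ {k l} → Above σ Point.point k l ⇔ PositiveUnderPath k l
    Above⇔labelled = mk⇔
      (λ ab@(k<l , σk<σl , _) → σk<σl , to (Point.Above⇔B k<l σk<σl) ab)
      (λ (σk<σl , k<rise) → from (Point.Above⇔B (underPath⇒< dyck k<rise) σk<σl) k<rise)

    valleys-minimal : ValleysAreMinimal P region
    valleys-minimal = mk⇔
      (λ v → from (Minimal-cong Above⇔labelled) (from labelled⇔path (to (valley⇔minimal dyck) v)))
      (λ min → from (valley⇔minimal dyck) (to labelled⇔path (to (Minimal-cong Above⇔labelled) min)))
      where
      labelled⇔path : ∀ {i j} → Minimal PositiveUnderPath i j ⇔ Minimal (UnderPath p) i j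
      labelled⇔path = minimal-restrict (underPath? p) (underPath⇒< dyck) proj₂
        (λ {i} {j} min → labelled i j (from (valley⇔minimal dyck) min) , proj₁ min)

    matches : Matches P region
    matches = from (matches⇔ P region) (Point.region-chamber , valleys-minimal)

    unique : ∀ R′ → Matches P R′ → R′ ≈R region
    unique R′ matches′ a b a<b = stratum-unique
      (chamber-stratum {σ = σ} R′ R′⊆σC {Point.point} Point.point-sorted a<b (stratum-≢0 t x∈t) (stratum-≢1 t x∈t) same-above)
      (proj₂ (sample∈R region) a b a<b)
      where
      R′⊆σC = proj₁ (to (matches⇔ P R′) matches′)
      valleys′ = proj₂ (to (matches⇔ P R′) matches′)
      t = proj₁ (Point.point-stratified a<b)
      x∈t = proj₂ (Point.point-stratified a<b)
      same-above : ∀ {k l} → Above σ (sample R′) k l ⇔ Above σ Point.point k l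
      same-above = mk⇔
        (Above-determined {σ = σ} {sample R′} {Point.point} Point.point-sorted (λ min → to valleys-minimal (from valleys′ min)))
        (Above-determined {σ = σ} {Point.point} {sample R′} R′⊆σC (λ min → to valleys′ (from valleys-minimal min)))

  module OfRegion (R : Region (suc m)) where

    private
      σ = proj₁ (chamberOf R)
      R⊆σC = proj₂ (chamberOf R)
      x₀ = sample R
      height = heightOf-height (above? σ x₀)

    g : ℕ → ℕ
    g = heightOf (above? σ x₀)

    heights : Heights (suc m) g (suc m)
    heights = record
      { bounded = λ l<n → ℕP.≤-trans (height-bounded height proj₁ l<n) (ℕP.<⇒≤ l<n)
      ; monotone = λ l≤l′ l′<n → height-mono height l≤l′ (ℕP.≤-<-trans l≤l′ l′<n)
      }

    path : List Step
    path = fromHeights (suc m) g (suc m)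

    rise≡g : ∀ {l} → l ℕ.< suc m → rise path l ≡ g l
    rise≡g = rise-fromHeights (suc m) g (suc m) heights

    dyck : IsDyck (suc m) path
    dyck = N≡n , E≡n , never-below path (ℕP.≤-reflexive (trans E≡n (sym N≡n)))
      (λ j<N → let j<n = subst (_ ℕ.<_) N≡n j<N in subst (ℕ._≤ _) (sym (rise≡g j<n)) (height-bounded height proj₁ j<n))
      where
      N≡n = countN-fromHeights (suc m) g (suc m) heights
      E≡n = countE-fromHeights (suc m) g (suc m) heights

    valleys-minimal : ∀ {i j} → Valley path i j ⇔ Minimal (Above σ x₀) i j
    valleys-minimal {i} {j} = mk⇔
      (λ v → to (corner⇔minimal height) (corner-cong (rise≡g ∘ below-j) (proj₁ (to valley⇔corner v))))
      (λ min → from valley⇔corner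
        ( corner-cong (sym ∘ rise≡g ∘ below-j) (from (corner⇔minimal height) min)
        , subst (_ ℕ.<_) (sym (countN-fromHeights (suc m) g (suc m) heights)) (FinP.toℕ<n j)))
      where
      below-j : ∀ {l} → l ℕ.≤ toℕ j → l ℕ.< suc m
      below-j l≤j = ℕP.≤-<-trans l≤j (FinP.toℕ<n j)

    labelled-path : DLDyck (suc m)
    labelled-path = path , σ , dyck , λ i j v → proj₁ (proj₂ (proj₁ (to valleys-minimal v)))

    matches : Matches labelled-path R
    matches = from (matches⇔ labelled-path R) (R⊆σC , valleys-minimal)

  valleys-transfer : ∀ (P Q : DLDyck (suc m)) {R} → Matches P R → Matches Q R →
                     (∀ i → proj₁ (proj₂ P) ⟨$⟩ʳ i ≡ proj₁ (proj₂ Q) ⟨$⟩ʳ i) →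
                     ∀ {a b} → ValleyAt (proj₁ P) a b → ValleyAt (proj₁ Q) a b
  valleys-transfer (p , σ , dyck , labelled) (q , τ , _) (_ , floorsP) (_ , floorsQ) σ≗τ {a} {b} v =
    let (i , j , i≡a , j≡b) = valley-fin dyck v
        v′ = subst₂ (ValleyAt p) (sym i≡a) (sym j≡b) v
        σi<σj = labelled i j v′
        (i′ , j′ , w , τi′≡σi , τj′≡σj) = proj₁ (floorsQ _ _ σi<σj) (proj₂ (floorsP _ _ σi<σj) (i , j , v′ , refl , refl))
        same : ∀ {k k′} → τ ⟨$⟩ʳ k′ ≡ σ ⟨$⟩ʳ k → toℕ k′ ≡ toℕ k
        same τk′≡σk = cong toℕ (⟨$⟩ʳ-injective τ (trans τk′≡σk (σ≗τ _)))
    in subst₂ (ValleyAt q) (trans (same τi′≡σi) i≡a) (trans (same τj′≡σj) j≡b) w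

  path-unique : (P Q : DLDyck (suc m)) (R : Region (suc m)) → Matches P R → Matches Q R → P ≈D Q
  path-unique P@(p , σ , (Np , Ep , _) , _) Q@(q , τ , (Nq , Eq , _) , _) R matchesP matchesQ =
    valleys-determine-path p q (trans Np (sym Nq)) (trans Ep (sym Eq))
      (valleys-transfer P Q {R} matchesP matchesQ σ≗τ) (valleys-transfer Q P {R} matchesQ matchesP (sym ∘ σ≗τ))
    , σ≗τ
    where
    σ≗τ : ∀ i → σ ⟨$⟩ʳ i ≡ τ ⟨$⟩ʳ i
    σ≗τ = sorted-unique {σ = σ} {τ} {sample R} (proj₁ (to (matches⇔ P R) matchesP)) (proj₁ (to (matches⇔ Q R) matchesQ))

proposition3p1 : (n : ℕ) → 1 ℕ.≤ n →
    ((P : DLDyck n) → Σ[ R ∈ Region n ] (Matches P R × ((R' : Region n) → Matches P R' → R' ≈R R)))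
    × ((R : Region n) → Σ[ P ∈ DLDyck n ] Matches P R)
    × ((P Q : DLDyck n) (R : Region n) → Matches P R → Matches Q R → P ≈D Q)
proposition3p1 (suc m) _ =
    (λ P → OfPath.region P , OfPath.matches P , OfPath.unique P)
  , (λ R → OfRegion.labelled-path R , OfRegion.matches R)
  , path-unique
  where
  open Correspondence {m}
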